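{- Let $q_1,\ldots,q_g$, $g\ge2$, and $D$ be as in the context. Let $p$ be a prime, $e_1,\ldots,e_g$ non-negative integers, and $\sigma\in S_g$ a permutation with $e_{\sigma(1)}\le\cdots\le e_{\sigma(g)}$. Then $$\rho(p^{e_1},\ldots,p^{e_g}) \ll (e_{\sigma(g)}-e_{\sigma(g-1)}+1)\,p^{2e_{\sigma(1)}+\cdots+2e_{\sigma(g-1)}+e_{\sigma(g)}}.$$ Also $$\rho(p,\ldots,p) = \rho^*(p,\ldots,p)+p^{2(g-1)} = p^{2(g-1)}+O(p),$$ and for all but finitely many primes $p$, for each $i=1,\ldots,g$, one has $\rho(\mathbf{e}^{(i)})\le 2p$, where $\mathbf{e}^{(i)}$ is the $g$-tuple with $p$ in position $i$ and $1$ in all other positions.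
   Context: $q_i(x,y)=a_ix^2+2b_ixy+c_iy^2$ ($i=1,\ldots,g$) are integer binary quadratic forms, irreducible over the integers, with $a_i\equiv 1\pmod 4$; $\delta_i$ is the discriminant of $q_i$ and $\mathrm{Res}(q_i,q_j)$ the resultant; $D:=\prod_{p\le 2g}p\prod_k a_kc_k\delta_k\prod_{i<j}\mathrm{Res}(q_i,q_j)\neq 0$. For positive integers $\mathbf{d}=(d_1,\ldots,d_g)$: $\Lambda_{\mathbf{d}} := \{\mathbf{x}\in\mathbb{Z}^2 : d_i\mid q_i(\mathbf{x}),\ i=1,\ldots,g\}$, $\rho(\mathbf{d}):=\#(\Lambda_{\mathbf{d}}\cap[0,d_1\cdots d_g)^2)$, $\Lambda^*_{\mathbf{d}}:=\{\mathbf{x}=(x_1,x_2)\in\Lambda_{\mathbf{d}}:\gcd(x_1,x_2,d_1\cdots d_g)=1\}$ and $\rho^*(\mathbf{d}):=\#(\Lambda^*_{\mathbf{d}}\cap[0,d_1\cdots d_g)^2)$. Implied constants may depend on the forms but not on $p$ or the $e_i$. -}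

module Defs where

open import Data.Bool using (Bool; true; false; if_then_else_)
open import Data.Nat as ℕ using (ℕ; zero; suc)
import Data.Nat.Divisibility as ℕD
open import Data.Nat.GCD using (gcd)
open import Data.Nat.Primality using (prime?)
open import Data.Integer as ℤ using (ℤ; +_)
open import Data.Fin using (Fin; _≟_)
import Data.Fin.Properties as FinP
open import Data.List using (List; length; filter; upTo; cartesianProduct)
open import Data.Product using (_×_; _,_; ∃)
open import Relation.Nullary using (¬_; Dec; does)
open import Relation.Nullary.Decidable using (_×-dec_)
open import Relation.Binary.PropositionalEquality using (_≡_)
import Data.Nat.Properties as ℕP

sumFin : (n : ℕ) → (Fin n → ℕ) → ℕ
sumFin zero    f = 0
sumFin (suc n) f = f Data.Fin.zero ℕ.+ sumFin n (λ i → f (Data.Fin.suc i))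

prodFin : (n : ℕ) → (Fin n → ℕ) → ℕ
prodFin zero    f = 1
prodFin (suc n) f = f Data.Fin.zero ℕ.* prodFin n (λ i → f (Data.Fin.suc i))

prodFinℤ : (n : ℕ) → (Fin n → ℤ) → ℤ
prodFinℤ zero    f = + 1
prodFinℤ (suc n) f = f Data.Fin.zero ℤ.* prodFinℤ n (λ i → f (Data.Fin.suc i))

prodPairsℤ : (n : ℕ) → (Fin n → Fin n → ℤ) → ℤ
prodPairsℤ zero    f = + 1
prodPairsℤ (suc n) f =
  prodFinℤ n (λ j → f Data.Fin.zero (Data.Fin.suc j))
  ℤ.* prodPairsℤ n (λ i j → f (Data.Fin.suc i) (Data.Fin.suc j))

primorialUpTo : ℕ → ℕ
primorialUpTo zero    = 1
primorialUpTo (suc n) =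
  (if does (prime? (suc n)) then suc n else 1) ℕ.* primorialUpTo n

evalQ : ℤ → ℤ → ℤ → ℤ → ℤ → ℤ
evalQ a b c x y = a ℤ.* x ℤ.* x ℤ.+ (+ 2) ℤ.* b ℤ.* x ℤ.* y ℤ.+ c ℤ.* y ℤ.* y

-- irreducible over ℤ: not a product (r x + s y)(t x + u y) of integer
-- linear forms (equality of polynomials = equality of coefficients)
IrreducibleQ : ℤ → ℤ → ℤ → Set
IrreducibleQ a b c =
  ¬ (∃ λ r → ∃ λ s → ∃ λ t → ∃ λ u →
       (r ℤ.* t ≡ a) × (r ℤ.* u ℤ.+ s ℤ.* t ≡ (+ 2) ℤ.* b) × (s ℤ.* u ≡ c))

discQ : ℤ → ℤ → ℤ → ℤ
discQ a b c = (+ 2) ℤ.* b ℤ.* ((+ 2) ℤ.* b) ℤ.- (+ 4) ℤ.* a ℤ.* c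

-- resultant of a₁x²+B₁xy+c₁y² and a₂x²+B₂xy+c₂y² (Sylvester determinant):
-- (a₁c₂ - a₂c₁)² - (a₁B₂ - a₂B₁)(B₁c₂ - B₂c₁), with Bᵢ = 2bᵢ
resQ : ℤ → ℤ → ℤ → ℤ → ℤ → ℤ → ℤ
resQ a₁ b₁ c₁ a₂ b₂ c₂ =
  (a₁ ℤ.* c₂ ℤ.- a₂ ℤ.* c₁) ℤ.* (a₁ ℤ.* c₂ ℤ.- a₂ ℤ.* c₁)
  ℤ.- (a₁ ℤ.* B₂ ℤ.- a₂ ℤ.* B₁) ℤ.* (B₁ ℤ.* c₂ ℤ.- B₂ ℤ.* c₁)
  where
  B₁ = (+ 2) ℤ.* b₁
  B₂ = (+ 2) ℤ.* b₂

bigD : (g : ℕ) → (a b c : Fin g → ℤ) → ℤ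
bigD g a b c =
  + primorialUpTo (2 ℕ.* g)
  ℤ.* prodFinℤ g (λ k → a k ℤ.* c k ℤ.* discQ (a k) (b k) (c k))
  ℤ.* prodPairsℤ g (λ i j → resQ (a i) (b i) (c i) (a j) (b j) (c j))

InLambda : (g : ℕ) → (a b c : Fin g → ℤ) → (Fin g → ℕ) → ℕ × ℕ → Set
InLambda g a b c d (x , y) =
  ∀ i → d i ℕD.∣ ℤ.∣ evalQ (a i) (b i) (c i) (+ x) (+ y) ∣

inLambda? : (g : ℕ) → (a b c : Fin g → ℤ) → (d : Fin g → ℕ) →
            (v : ℕ × ℕ) → Dec (InLambda g a b c d v)
inLambda? g a b c d (x , y) =
  FinP.all? (λ i → d i ℕD.∣? ℤ.∣ evalQ (a i) (b i) (c i) (+ x) (+ y) ∣)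

InLambdaStar : (g : ℕ) → (a b c : Fin g → ℤ) → (Fin g → ℕ) → ℕ × ℕ → Set
InLambdaStar g a b c d (x , y) =
  InLambda g a b c d (x , y) × (gcd (gcd x y) (prodFin g d) ≡ 1)

inLambdaStar? : (g : ℕ) → (a b c : Fin g → ℤ) → (d : Fin g → ℕ) →
                (v : ℕ × ℕ) → Dec (InLambdaStar g a b c d v)
inLambdaStar? g a b c d (x , y) =
  inLambda? g a b c d (x , y) ×-dec (gcd (gcd x y) (prodFin g d) ℕP.≟ 1)

box : (g : ℕ) → (Fin g → ℕ) → List (ℕ × ℕ)
box g d = cartesianProduct (upTo (prodFin g d)) (upTo (prodFin g d))

rho : (g : ℕ) → (a b c : Fin g → ℤ) → (Fin g → ℕ) → ℕ
rho g a b c d = length (filter (inLambda? g a b c d) (box g d))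

rhoStar : (g : ℕ) → (a b c : Fin g → ℤ) → (Fin g → ℕ) → ℕ
rhoStar g a b c d = length (filter (inLambdaStar? g a b c d) (box g d))

unitTuple : {g : ℕ} → ℕ → Fin g → Fin g → ℕ
unitTuple p i j = if does (j ≟ i) then p else 1

{-# OPTIONS --safe #-}
-- Only the two conditions with the largest exponents E ≥ F matter. Points whose coordinates are
-- both divisible by p^⌈E/2⌉ are few. Otherwise let p^k be the exact power of p dividing both
-- coordinates: dividing it out leaves a common zero of the two forms modulo p^(F − 2k) with a
-- coordinate prime to p, so F < 2k + |Res|, which leaves E − F + |Res| + 1 possible values of k.
-- For fixed k, in each row x with p^k ∥ x the solutions y of p^E ∣ q(x, y) lie in two residue
-- classes modulo p^(E − k − O(1)), the two roots of a quadratic in y, which cannot stay close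
-- beyond the valuation of the discriminant. The statements at p are the same ideas modulo p:
-- primitive common zeros force p ∣ Res, and for p ∤ D a quadratic in y has at most two roots.
module Submission where

module Counting where

  open import Data.Nat using (ℕ; zero; suc; _+_; _*_; _≤_; _<_; z≤n; s≤s; z<s)
  open import Data.Nat.Properties
  open import Algebra.Properties.CommutativeSemigroup +-commutativeSemigroup using (interchange)
  open import Data.List using ([]; _∷_; length; filter; map; _++_; applyUpTo; upTo; cartesianProduct)
  open import Data.List.Properties using (filter-++; length-++)
  open import Data.Product using (_×_; _,_; ∃)
  open import Data.Sum using (_⊎_; inj₁; inj₂)
  open import Data.Empty using (⊥-elim)
  open import Function using (_∘_)
  open import Relation.Nullary using (¬_; Dec; yes; no)
  open import Relation.Nullary.Decidable using (_×-dec_)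
  open import Relation.Unary using (Pred; Decidable)
  open import Relation.Binary.PropositionalEquality
  open import Level using (Level)

  private
    variable
      a b c p : Level
      A : Set a
      B : Set b
      C : Set c
      P Q R : Pred ℕ p

  ∑ : ℕ → ℕ → (ℕ → ℕ) → ℕ
  ∑ s zero    f = 0
  ∑ s (suc n) f = f s + ∑ (suc s) n f

  ∑-cong : ∀ s n {f g} → (∀ y → f y ≡ g y) → ∑ s n f ≡ ∑ s n g
  ∑-cong s zero    f≗g = refl
  ∑-cong s (suc n) f≗g = cong₂ _+_ (f≗g s) (∑-cong (suc s) n f≗g)

  ∑-mono-≤ : ∀ s n {f g} → (∀ y → f y ≤ g y) → ∑ s n f ≤ ∑ s n g
  ∑-mono-≤ s zero    f≤g = z≤n
  ∑-mono-≤ s (suc n) f≤g = +-mono-≤ (f≤g s) (∑-mono-≤ (suc s) n f≤g)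

  ∑-distrib-+ : ∀ s n f g → ∑ s n (λ y → f y + g y) ≡ ∑ s n f + ∑ s n g
  ∑-distrib-+ s zero    f g = refl
  ∑-distrib-+ s (suc n) f g =
    trans (cong ((f s + g s) +_) (∑-distrib-+ (suc s) n f g)) (interchange (f s) (g s) _ _)

  ∑-distribˡ-* : ∀ s n c f → ∑ s n (λ y → c * f y) ≡ c * ∑ s n f
  ∑-distribˡ-* s zero    c f = sym (*-zeroʳ c)
  ∑-distribˡ-* s (suc n) c f =
    trans (cong (c * f s +_) (∑-distribˡ-* (suc s) n c f)) (sym (*-distribˡ-+ c (f s) _))

  ∑-const : ∀ s n c → ∑ s n (λ _ → c) ≡ n * c
  ∑-const s zero    c = refl
  ∑-const s (suc n) c = cong (c +_) (∑-const (suc s) n c)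

  ∑-≤-const : ∀ s n {f} B → (∀ y → f y ≤ B) → ∑ s n f ≤ n * B
  ∑-≤-const s n B f≤B = ≤-trans (∑-mono-≤ s n f≤B) (≤-reflexive (∑-const s n B))

  ∑-++ : ∀ s m n f → ∑ s (m + n) f ≡ ∑ s m f + ∑ (s + m) n f
  ∑-++ s zero    n f = cong (λ t → ∑ t n f) (sym (+-identityʳ s))
  ∑-++ s (suc m) n f = begin
    f s + ∑ (suc s) (m + n) f                   ≡⟨ cong (f s +_) (∑-++ (suc s) m n f) ⟩
    f s + (∑ (suc s) m f + ∑ (suc s + m) n f)   ≡⟨ cong (λ t → f s + (∑ (suc s) m f + ∑ t n f)) (sym (+-suc s m)) ⟩
    f s + (∑ (suc s) m f + ∑ (s + suc m) n f)   ≡⟨ sym (+-assoc (f s) _ _) ⟩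
    f s + ∑ (suc s) m f + ∑ (s + suc m) n f     ∎
    where open ≡-Reasoning

  ∑-comm : ∀ s n t m (f : ℕ → ℕ → ℕ) →
           ∑ s n (λ x → ∑ t m (f x)) ≡ ∑ t m (λ y → ∑ s n (λ x → f x y))
  ∑-comm s zero    t m f = sym (trans (∑-const t m 0) (*-zeroʳ m))
  ∑-comm s (suc n) t m f = trans (cong (∑ t m (f s) +_) (∑-comm (suc s) n t m f))
                                 (sym (∑-distrib-+ t m (f s) _))

  ∑-shift : ∀ s n f → ∑ (suc s) n f ≡ ∑ s n (f ∘ suc)
  ∑-shift s zero    f = refl
  ∑-shift s (suc n) f = cong (f (suc s) +_) (∑-shift (suc s) n f)

  term≤∑ : ∀ s n f {k} → s ≤ k → k < s + n → f k ≤ ∑ s n f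
  term≤∑ s zero    f s≤k k<s+0 = ⊥-elim (<-irrefl refl (<-≤-trans k<s+0 (≤-trans (≤-reflexive (+-identityʳ s)) s≤k)))
  term≤∑ s (suc n) f {k} s≤k k<s+1+n with s ≟ k
  ... | yes refl = m≤m+n (f s) _
  ... | no s≢k   = ≤-trans (term≤∑ (suc s) n f (≤∧≢⇒< s≤k s≢k) (<-≤-trans k<s+1+n (≤-reflexive (+-suc s n))))
                           (m≤n+m _ (f s))

  ∑-positive : ∀ s n f → 0 < ∑ s n f → ∃ λ y → 0 < f y
  ∑-positive s (suc n) f 0<∑ with f s in fs≡
  ... | suc _ = s , subst (0 <_) (sym fs≡) z<s
  ... | zero  = ∑-positive (suc s) n f 0<∑

  indicator : Dec A → ℕ
  indicator (yes _) = 1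
  indicator (no _)  = 0

  indicator≤1 : (A? : Dec A) → indicator A? ≤ 1
  indicator≤1 (yes _) = ≤-refl
  indicator≤1 (no _)  = z≤n

  indicator-yes : (A? : Dec A) → A → indicator A? ≡ 1
  indicator-yes (yes _) _ = refl
  indicator-yes (no ¬a) a = ⊥-elim (¬a a)

  indicator-no : (A? : Dec A) → ¬ A → indicator A? ≡ 0
  indicator-no (yes a) ¬a = ⊥-elim (¬a a)
  indicator-no (no _)  _  = refl

  indicator-positive : (A? : Dec A) → 0 < indicator A? → A
  indicator-positive (yes a) _ = a

  indicator-mono : (A? : Dec A) (B? : Dec B) → (A → B) → indicator A? ≤ indicator B?
  indicator-mono (yes a) (yes _) _   = ≤-refl
  indicator-mono (yes a) (no ¬b) A⇒B = ⊥-elim (¬b (A⇒B a))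
  indicator-mono (no _)  _       _   = z≤n

  indicator-× : (A? : Dec A) (B? : Dec B) → indicator (A? ×-dec B?) ≡ indicator A? * indicator B?
  indicator-× (yes _) (yes _) = refl
  indicator-× (yes _) (no _)  = refl
  indicator-× (no _)  (yes _) = refl
  indicator-× (no _)  (no _)  = refl

  indicator-partition : (A? : Dec A) (B? : Dec B) (C? : Dec C) → (C → A) → (A → B → ¬ C) → (A → ¬ C → B) →
                        indicator A? ≡ indicator (A? ×-dec B?) + indicator C?
  indicator-partition (yes a) (yes b) (yes c) _   disjoint _     = ⊥-elim (disjoint a b c)
  indicator-partition (yes a) (yes b) (no _)  _   _        _     = refl
  indicator-partition (yes a) (no _)  (yes c) _   _        _     = refl
  indicator-partition (yes a) (no ¬b) (no ¬c) _   _        cover = ⊥-elim (¬b (cover a ¬c))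
  indicator-partition (no ¬a) _       (yes c) C⇒A _        _     = ⊥-elim (¬a (C⇒A c))
  indicator-partition (no _)  _       (no _)  _   _        _     = refl

  indicator-⊎ : (A? : Dec A) (B? : Dec B) (C? : Dec C) →
                (A → B ⊎ C) → indicator A? ≤ indicator B? + indicator C?
  indicator-⊎ (no _)  _       _       _     = z≤n
  indicator-⊎ (yes _) (yes _) _       _     = s≤s z≤n
  indicator-⊎ (yes _) (no _)  (yes _) _     = ≤-refl
  indicator-⊎ (yes a) (no ¬b) (no ¬c) A⇒B∪C with A⇒B∪C a
  ... | inj₁ b = ⊥-elim (¬b b)
  ... | inj₂ c = ⊥-elim (¬c c)

  private
    within-suc : ∀ {s n y} → suc s ≤ y → y < suc s + n → s ≤ y × y < s + suc n
    within-suc {s} {n} s<y y<e = <⇒≤ s<y , <-≤-trans y<e (≤-reflexive (sym (+-suc s n)))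

  count : Decidable P → ℕ → ℕ → ℕ
  count P? s n = ∑ s n (λ y → indicator (P? y))

  count-mono : (P? : Decidable P) (Q? : Decidable Q) → ∀ s n →
               (∀ {y} → P y → Q y) → count P? s n ≤ count Q? s n
  count-mono P? Q? s n P⊆Q = ∑-mono-≤ s n (λ y → indicator-mono (P? y) (Q? y) P⊆Q)

  count-∪ : (P? : Decidable P) (Q? : Decidable Q) (R? : Decidable R) → ∀ s n →
            (∀ {y} → P y → Q y ⊎ R y) → count P? s n ≤ count Q? s n + count R? s n
  count-∪ P? Q? R? s n P⊆Q∪R = ≤-trans (∑-mono-≤ s n (λ y → indicator-⊎ (P? y) (Q? y) (R? y) P⊆Q∪R))
                                       (≤-reflexive (∑-distrib-+ s n _ _))

  count≡0⊎∃ : (P? : Decidable P) → ∀ s n → count P? s n ≡ 0 ⊎ ∃ P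
  count≡0⊎∃ P? s n with count P? s n in count≡
  ... | zero  = inj₁ refl
  ... | suc _ with ∑-positive s n (λ y → indicator (P? y)) (subst (0 <_) (sym count≡) z<s)
  ...   | y , 0<1[Py] = inj₂ (y , indicator-positive (P? y) 0<1[Py])

  count-empty : (P? : Decidable P) → ∀ s n → (∀ {y} → s ≤ y → y < s + n → ¬ P y) → count P? s n ≡ 0
  count-empty P? s zero    ¬P = refl
  count-empty P? s (suc n) ¬P = cong₂ _+_ (indicator-no (P? s) (¬P ≤-refl (m<m+n s z<s)))
    (count-empty P? (suc s) n (λ s<y y<e → let s≤y , y<e′ = within-suc s<y y<e in ¬P s≤y y<e′))

  count-≤1 : (P? : Decidable P) → ∀ s n →
             (∀ {y y′} → s ≤ y → y < s + n → s ≤ y′ → y′ < s + n → P y → P y′ → y ≡ y′) →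
             count P? s n ≤ 1
  count-≤1 P? s zero    unique = z≤n
  count-≤1 P? s (suc n) unique with P? s
  ... | yes Ps = ≤-reflexive (cong suc (count-empty P? (suc s) n (λ s<y y<e Py →
                   let s≤y , y<e′ = within-suc s<y y<e in
                   <-irrefl (unique ≤-refl (m<m+n s z<s) s≤y y<e′ Ps Py) s<y)))
  ... | no ¬Ps = count-≤1 P? (suc s) n (λ s<y y<e s<y′ y′<e →
                   let s≤y , y<e₁ = within-suc s<y y<e ; s≤y′ , y′<e₁ = within-suc s<y′ y′<e in
                   unique s≤y y<e₁ s≤y′ y′<e₁)

  ∑² : ℕ → (ℕ × ℕ → ℕ) → ℕ
  ∑² N f = ∑ 0 N (λ x → ∑ 0 N (λ y → f (x , y)))

  ∑²-cong : ∀ N {f g} → (∀ z → f z ≡ g z) → ∑² N f ≡ ∑² N g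
  ∑²-cong N f≗g = ∑-cong 0 N (λ x → ∑-cong 0 N (λ y → f≗g (x , y)))

  ∑²-mono-≤ : ∀ N {f g} → (∀ z → f z ≤ g z) → ∑² N f ≤ ∑² N g
  ∑²-mono-≤ N f≤g = ∑-mono-≤ 0 N (λ x → ∑-mono-≤ 0 N (λ y → f≤g (x , y)))

  ∑²-distrib-+ : ∀ N f g → ∑² N (λ z → f z + g z) ≡ ∑² N f + ∑² N g
  ∑²-distrib-+ N f g = trans (∑-cong 0 N (λ x → ∑-distrib-+ 0 N _ _)) (∑-distrib-+ 0 N _ _)

  ∑²-∑-comm : ∀ N s n (f : ℕ → ℕ × ℕ → ℕ) → ∑² N (λ z → ∑ s n (λ k → f k z)) ≡ ∑ s n (λ k → ∑² N (f k))
  ∑²-∑-comm N s n f = trans (∑-cong 0 N (λ x → ∑-comm 0 N s n (λ y k → f k (x , y))))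
                            (∑-comm 0 N s n (λ x k → ∑ 0 N (λ y → f k (x , y))))

  count² : {P : Pred (ℕ × ℕ) p} → Decidable P → ℕ → ℕ
  count² P? N = ∑² N (λ z → indicator (P? z))

  module _ {P : Pred A p} (P? : Decidable P) where

    length-filter-++ : ∀ xs ys → length (filter P? (xs ++ ys)) ≡ length (filter P? xs) + length (filter P? ys)
    length-filter-++ xs ys = trans (cong length (filter-++ P? xs ys)) (length-++ (filter P? xs))

    length-filter-map : ∀ (f : B → A) xs → length (filter P? (map f xs)) ≡ length (filter (P? ∘ f) xs)
    length-filter-map f []       = refl
    length-filter-map f (x ∷ xs) with P? (f x)
    ... | yes _ = cong suc (length-filter-map f xs)
    ... | no  _ = length-filter-map f xs

    length-filter-applyUpTo : ∀ (f : ℕ → A) n → length (filter P? (applyUpTo f n)) ≡ ∑ 0 n (λ i → indicator (P? (f i)))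
    length-filter-applyUpTo f zero    = refl
    length-filter-applyUpTo f (suc n) with P? (f 0)
    ... | yes _ = cong suc (trans (length-filter-applyUpTo (f ∘ suc) n) (sym (∑-shift 0 n _)))
    ... | no  _ = trans (length-filter-applyUpTo (f ∘ suc) n) (sym (∑-shift 0 n _))

  length-filter-grid : {P : Pred (ℕ × B) p} (P? : Decidable P) → ∀ (f : ℕ → ℕ) n ys →
                       length (filter P? (cartesianProduct (applyUpTo f n) ys))
                       ≡ ∑ 0 n (λ i → length (filter (λ y → P? (f i , y)) ys))
  length-filter-grid P? f zero    ys = refl
  length-filter-grid P? f (suc n) ys = begin
    length (filter P? (map (f 0 ,_) ys ++ cartesianProduct (applyUpTo (f ∘ suc) n) ys))
      ≡⟨ length-filter-++ P? (map (f 0 ,_) ys) _ ⟩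
    length (filter P? (map (f 0 ,_) ys)) + length (filter P? (cartesianProduct (applyUpTo (f ∘ suc) n) ys))
      ≡⟨ cong₂ _+_ (length-filter-map P? (f 0 ,_) ys) (length-filter-grid P? (f ∘ suc) n ys) ⟩
    row 0 + ∑ 0 n (row ∘ suc)
      ≡⟨ cong (row 0 +_) (sym (∑-shift 0 n row)) ⟩
    row 0 + ∑ 1 n row ∎
    where
    open ≡-Reasoning
    row : ℕ → ℕ
    row i = length (filter (λ y → P? (f i , y)) ys)

  length-filter-square : {P : Pred (ℕ × ℕ) p} (P? : Decidable P) → ∀ N →
                         length (filter P? (cartesianProduct (upTo N) (upTo N))) ≡ count² P? N
  length-filter-square P? N = trans (length-filter-grid P? (λ i → i) N (upTo N))
    (∑-cong 0 N (λ x → length-filter-applyUpTo (λ y → P? (x , y)) (λ i → i) N))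

  count²-mono : {P Q : Pred (ℕ × ℕ) p} (P? : Decidable P) (Q? : Decidable Q) → ∀ N →
                (∀ {z} → P z → Q z) → count² P? N ≤ count² Q? N
  count²-mono P? Q? N P⊆Q = ∑²-mono-≤ N (λ z → indicator-mono (P? z) (Q? z) P⊆Q)

  count²-transpose : {P : Pred (ℕ × ℕ) p} (P? : Decidable P) → ∀ N → count² (λ (x , y) → P? (y , x)) N ≡ count² P? N
  count²-transpose P? N = ∑-comm 0 N 0 N (λ x y → indicator (P? (y , x)))

  count²-empty : {P : Pred (ℕ × ℕ) p} (P? : Decidable P) → ∀ N → (∀ z → ¬ P z) → count² P? N ≡ 0
  count²-empty P? N ¬P = trans (∑-cong 0 N (λ x → count-empty (λ y → P? (x , y)) 0 N (λ _ _ → ¬P (x , _))))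
                               (trans (∑-const 0 N 0) (*-zeroʳ N))

  count²-≤ : {P : Pred (ℕ × ℕ) p} (P? : Decidable P) → ∀ N → count² P? N ≤ N * N
  count²-≤ P? N = ∑-≤-const 0 N N (λ x →
    ≤-trans (∑-≤-const 0 N 1 (λ y → indicator≤1 (P? (x , y)))) (≤-reflexive (*-identityʳ N)))

  count²-× : {Q : Pred ℕ p} (Q? : Decidable Q) → ∀ N →
             count² (λ (x , y) → Q? x ×-dec Q? y) N ≡ count Q? 0 N * count Q? 0 N
  count²-× Q? N = begin
    ∑ 0 N (λ x → ∑ 0 N (λ y → indicator (Q? x ×-dec Q? y)))   ≡⟨ ∑-cong 0 N (λ x → ∑-cong 0 N (λ y → indicator-× (Q? x) (Q? y))) ⟩
    ∑ 0 N (λ x → ∑ 0 N (λ y → indicator (Q? x) * indicator (Q? y)))  ≡⟨ ∑-cong 0 N (λ x → ∑-distribˡ-* 0 N (indicator (Q? x)) _) ⟩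
    ∑ 0 N (λ x → indicator (Q? x) * count Q? 0 N)           ≡⟨ ∑-cong 0 N (λ x → *-comm (indicator (Q? x)) _) ⟩
    ∑ 0 N (λ x → count Q? 0 N * indicator (Q? x))           ≡⟨ ∑-distribˡ-* 0 N (count Q? 0 N) _ ⟩
    count Q? 0 N * count Q? 0 N                              ∎
    where open ≡-Reasoning

  count²-≤-rows : {P : Pred (ℕ × ℕ) p} {R : Pred ℕ p} (P? : Decidable P) (R? : Decidable R) → ∀ N B →
                  (∀ {x y} → P (x , y) → R x) → (∀ {x} → R x → count (λ y → P? (x , y)) 0 N ≤ B) →
                  count² P? N ≤ B * count R? 0 N
  count²-≤-rows P? R? N B P⇒R row≤B = ≤-trans (∑-mono-≤ 0 N row) (≤-reflexive (∑-distribˡ-* 0 N B _))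
    where
    row : ∀ x → count (λ y → P? (x , y)) 0 N ≤ B * indicator (R? x)
    row x with R? x
    ... | yes Rx = ≤-trans (row≤B Rx) (≤-reflexive (sym (*-identityʳ B)))
    ... | no ¬Rx = ≤-reflexive (trans (count-empty (λ y → P? (x , y)) 0 N (λ _ _ Pxy → ¬Rx (P⇒R Pxy)))
                                      (sym (*-zeroʳ B)))

module Congruences where

  open import Data.Nat using (ℕ; zero; suc; _+_; _*_; _∸_; _≤_; _<_; z≤n)
  open import Data.Nat.Properties
  open import Data.Nat.Divisibility using (_∣_; _∣?_; _∣0; ∣-refl; ∣m∣n⇒∣m+n; >⇒∤; *-pres-∣)
  open import Data.Integer as ℤ using (ℤ; +_)
  import Data.Integer.Properties as ℤ
  import Data.Integer.Divisibility.Signed as ℤ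
  open import Data.Integer.Tactic.RingSolver using (solve-∀)
  open import Data.Product using (_×_; _,_)
  open import Data.Sum as Sum using (_⊎_; inj₁; inj₂)
  open import Data.Empty using (⊥-elim)
  open import Level using (Level)
  open import Relation.Nullary using (Dec)
  open import Relation.Nullary.Decidable using (_×-dec_; map′)
  open import Relation.Unary using (Pred; Decidable)
  open import Relation.Binary.PropositionalEquality

  open Counting

  private
    variable
      p : Level
      P : Pred ℕ p

  infix 4 _∣ℤ_ _≡_[mod_] _≡?_[mod_]

  -- Unsigned, as in Defs.InLambda: membership in Λ_d is literally a family of these.
  _∣ℤ_ : ℕ → ℤ → Set
  n ∣ℤ i = n ∣ ℤ.∣ i ∣

  module _ {n : ℕ} where

    private
      signed : ∀ i → n ∣ℤ i → + n ℤ.∣ i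
      signed i = ℤ.∣ᵤ⇒∣ {k = + n} {i = i}

      unsigned : ∀ i → + n ℤ.∣ i → n ∣ℤ i
      unsigned i = ℤ.∣⇒∣ᵤ {k = + n} {i = i}

    ∣ℤ-+ : ∀ i j → n ∣ℤ i → n ∣ℤ j → n ∣ℤ i ℤ.+ j
    ∣ℤ-+ i j n∣i n∣j = unsigned (i ℤ.+ j) (ℤ.∣m∣n⇒∣m+n (signed i n∣i) (signed j n∣j))

    ∣ℤ-- : ∀ i j → n ∣ℤ i → n ∣ℤ j → n ∣ℤ i ℤ.- j
    ∣ℤ-- i j n∣i n∣j = unsigned (i ℤ.- j) (ℤ.∣m∣n⇒∣m-n (signed i n∣i) (signed j n∣j))

    ∣ℤ-*ˡ : ∀ i j → n ∣ℤ j → n ∣ℤ i ℤ.* j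
    ∣ℤ-*ˡ i j n∣j = unsigned (i ℤ.* j) (ℤ.∣n⇒∣m*n i (signed j n∣j))

  ∣ℤ-* : ∀ {m n} i j → m ∣ℤ i → n ∣ℤ j → m * n ∣ℤ i ℤ.* j
  ∣ℤ-* i j m∣i n∣j = subst (_ ∣_) (sym (ℤ.abs-* i j)) (*-pres-∣ m∣i n∣j)

  -- A record rather than a synonym, so that y, y′ and M can be inferred from a proof.
  record _≡_[mod_] (y y′ M : ℕ) : Set where
    constructor modulus∣
    field
      ∣difference : M ∣ℤ + y ℤ.- + y′

  open _≡_[mod_] public

  _≡?_[mod_] : ∀ y y′ M → Dec (y ≡ y′ [mod M ])
  y ≡? y′ [mod M ] = map′ modulus∣ ∣difference (M ∣? ℤ.∣ + y ℤ.- + y′ ∣)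

  module _ {M : ℕ} where

    ≡[mod]-sym : ∀ {y y′} → y ≡ y′ [mod M ] → y′ ≡ y [mod M ]
    ≡[mod]-sym {y} {y′} (modulus∣ M∣y-y′) =
      modulus∣ (subst (M ∣_) (ℤ.∣i-j∣≡∣j-i∣ (+ y) (+ y′)) M∣y-y′)

    ≡[mod]-trans : ∀ {y y′ y″} → y ≡ y′ [mod M ] → y′ ≡ y″ [mod M ] → y ≡ y″ [mod M ]
    ≡[mod]-trans {y} {y′} {y″} (modulus∣ M∣y-y′) (modulus∣ M∣y′-y″) = modulus∣
      (subst (M ∣ℤ_) (telescope (+ y) (+ y′) (+ y″))
             (∣ℤ-+ (+ y ℤ.- + y′) (+ y′ ℤ.- + y″) M∣y-y′ M∣y′-y″))
      where
      telescope : ∀ (a b c : ℤ) → (a ℤ.- b) ℤ.+ (b ℤ.- c) ≡ a ℤ.- c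
      telescope = solve-∀

    ≡[mod]-≤⇒∣∸ : ∀ {y y′} → y ≤ y′ → y ≡ y′ [mod M ] → M ∣ y′ ∸ y
    ≡[mod]-≤⇒∣∸ {y} {y′} y≤y′ (modulus∣ M∣y-y′) =
      subst (M ∣_) (trans (cong ℤ.∣_∣ (ℤ.m-n≡m⊖n y y′)) (ℤ.∣⊖∣-≤ y≤y′)) M∣y-y′

    ∣∧<⇒≡0 : ∀ {d} → M ∣ d → d < M → d ≡ 0
    ∣∧<⇒≡0 {zero}  _   _   = refl
    ∣∧<⇒≡0 {suc d} M∣d d<M = ⊥-elim (>⇒∤ d<M M∣d)

    ≡[mod]-≤-close⇒≡ : ∀ {y y′} → y ≤ y′ → y′ < y + M → y ≡ y′ [mod M ] → y ≡ y′
    ≡[mod]-≤-close⇒≡ {y} {y′} y≤y′ y′<y+M y≡y′ = ≤-antisym y≤y′ (m∸n≡0⇒m≤n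
      (∣∧<⇒≡0 (≡[mod]-≤⇒∣∸ y≤y′ y≡y′) (subst (y′ ∸ y <_) (m+n∸m≡n y M) (∸-monoˡ-< y′<y+M y≤y′))))

    ≡[mod]-close⇒≡ : ∀ {y y′} → y < y′ + M → y′ < y + M → y ≡ y′ [mod M ] → y ≡ y′
    ≡[mod]-close⇒≡ {y} {y′} y<y′+M y′<y+M y≡y′ with ≤-total y y′
    ... | inj₁ y≤y′ = ≡[mod]-≤-close⇒≡ y≤y′ y′<y+M y≡y′
    ... | inj₂ y′≤y = sym (≡[mod]-≤-close⇒≡ y′≤y y<y′+M (≡[mod]-sym y≡y′))

  module _ {M : ℕ} (0<M : 0 < M) where

    count-congruent : ∀ r m s → count (λ y → y ≡? r [mod M ]) s (m * M) ≤ m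
    count-congruent r zero    s = z≤n
    count-congruent r (suc m) s = begin
      count r? s (M + m * M)                   ≡⟨ ∑-++ s M (m * M) _ ⟩
      count r? s M + count r? (s + M) (m * M)  ≤⟨ +-mono-≤ block (count-congruent r m (s + M)) ⟩
      1 + m                                    ∎
      where
      open ≤-Reasoning
      r? = λ y → y ≡? r [mod M ]
      block : count r? s M ≤ 1
      block = count-≤1 r? s M (λ s≤y y<s+M s≤y′ y′<s+M y≡r y′≡r →
        ≡[mod]-close⇒≡ (<-≤-trans y<s+M (+-monoˡ-≤ M s≤y′)) (<-≤-trans y′<s+M (+-monoˡ-≤ M s≤y))
                       (≡[mod]-trans y≡r (≡[mod]-sym y′≡r)))

    count-multiples : ∀ m → count (M ∣?_) 0 (m * M) ≡ m
    count-multiples m = ≤-antisym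
      (≤-trans (count-mono (M ∣?_) (λ y → y ≡? 0 [mod M ]) 0 (m * M) ≡0) (count-congruent 0 m 0))
      (at-least m 0 (M ∣0))
      where
      ≡0 : ∀ {y} → M ∣ y → y ≡ 0 [mod M ]
      ≡0 {y} M∣y = modulus∣ (subst (M ∣_) (sym (+-identityʳ y)) M∣y)
      at-least : ∀ m s → M ∣ s → m ≤ count (M ∣?_) s (m * M)
      at-least zero    s _   = z≤n
      at-least (suc m) s M∣s = begin
        1 + m                                              ≤⟨ +-mono-≤ first (at-least m (s + M) (∣m∣n⇒∣m+n M∣s ∣-refl)) ⟩
        count (M ∣?_) s M + count (M ∣?_) (s + M) (m * M)  ≡⟨ ∑-++ s M (m * M) _ ⟨
        count (M ∣?_) s (M + m * M)                        ∎
        where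
        open ≤-Reasoning
        first : 1 ≤ count (M ∣?_) s M
        first = subst (_≤ count (M ∣?_) s M) (indicator-yes (M ∣? s) M∣s)
                      (term≤∑ s M _ ≤-refl (m<m+n s 0<M))

    count-one-class : (P? : Decidable P) → ∀ m → (∀ {y y′} → P y → P y′ → y ≡ y′ [mod M ]) →
                      count P? 0 (m * M) ≤ m
    count-one-class P? m congruent with count≡0⊎∃ P? 0 (m * M)
    ... | inj₁ count≡0    = ≤-trans (≤-reflexive count≡0) z≤n
    ... | inj₂ (y′ , Py′) = ≤-trans (count-mono P? (λ y → y ≡? y′ [mod M ]) 0 (m * M) (λ Py → congruent Py Py′))
                                    (count-congruent y′ m 0)

    count-two-classes : (P? : Decidable P) → ∀ m {r} {R : ℕ → Pred ℕ r} → (∀ y₁ → Decidable (R y₁)) →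
                        (∀ {y₁ y} → P y₁ → P y → y ≡ y₁ [mod M ] ⊎ R y₁ y) →
                        (∀ {y₁ y y′} → R y₁ y → R y₁ y′ → y ≡ y′ [mod M ]) →
                        count P? 0 (m * M) ≤ 2 * m
    count-two-classes {P = P} P? m {R = R} R? congruent⊎R R-congruent with count≡0⊎∃ P? 0 (m * M)
    ... | inj₁ count≡0    = ≤-trans (≤-reflexive count≡0) z≤n
    ... | inj₂ (y₁ , Py₁) = begin
      count P? 0 (m * M)                            ≤⟨ count-∪ P? ≡y₁? Ry₁∩P? 0 (m * M) split ⟩
      count ≡y₁? 0 (m * M) + count Ry₁∩P? 0 (m * M) ≤⟨ +-mono-≤ (count-congruent y₁ m 0) (count-one-class Ry₁∩P? m R-congruent′) ⟩
      m + m                                         ≡⟨ cong (_+_ m) (+-identityʳ m) ⟨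
      2 * m                                         ∎
      where
      open ≤-Reasoning
      ≡y₁? = λ y → y ≡? y₁ [mod M ]
      Ry₁∩P? = λ y → R? y₁ y ×-dec P? y
      split : ∀ {y} → P y → y ≡ y₁ [mod M ] ⊎ (R y₁ y × P y)
      split Py = Sum.map₂ (_, Py) (congruent⊎R Py₁ Py)
      R-congruent′ : ∀ {y y′} → R y₁ y × P y → R y₁ y′ × P y′ → y ≡ y′ [mod M ]
      R-congruent′ (Ry , _) (Ry′ , _) = R-congruent Ry Ry′

module PrimePowers where

  open import Data.Nat using (ℕ; zero; suc; _+_; _*_; _∸_; _^_; _≤_; _<_; z≤n; s≤s; NonZero; >-nonZero; nonTrivial⇒n>1)
  open import Data.Nat.Properties
  open import Data.Nat.Divisibility
  open import Data.Nat.Primality using (Prime; euclidsLemma; prime⇒nonZero; prime⇒nonTrivial; prime⇒irreducible)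
  open import Data.Nat.Coprimality using (Coprime; coprime-divisor)
  open import Data.Nat.Tactic.RingSolver using (solve-∀)
  open import Data.Product using (_×_; _,_; ∃; ∃₂)
  open import Data.Sum using (_⊎_; inj₁; inj₂)
  open import Data.Empty using (⊥-elim)
  open import Relation.Nullary using (¬_; Dec; yes; no)
  open import Relation.Nullary.Decidable using (_×-dec_; ¬?)
  open import Relation.Unary using (Pred; Decidable)
  open import Relation.Binary.PropositionalEquality

  module _ {ℓ} {Q : Pred ℕ ℓ} (Q? : Decidable Q) where

    boundary : ∀ H → Q 0 → ¬ Q H → ∃ λ k → k < H × Q k × ¬ Q (suc k)
    boundary zero    Q0 ¬QH = ⊥-elim (¬QH Q0)
    boundary (suc H) Q0 ¬QH with Q? H
    ... | yes QH  = H , ≤-refl , QH , ¬QH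
    ... | no ¬QH′ = let k , k<H , Qk , ¬Qk+1 = boundary H Q0 ¬QH′ in k , m≤n⇒m≤1+n k<H , Qk , ¬Qk+1

  infix 4 _^_∥_ _^_∥?_

  _^_∥_ : ℕ → ℕ → ℕ → Set
  p ^ k ∥ x = p ^ k ∣ x × p ^ suc k ∤ x

  _^_∥?_ : ∀ p k x → Dec (p ^ k ∥ x)
  p ^ k ∥? x = p ^ k ∣? x ×-dec ¬? (p ^ suc k ∣? x)

  prime>1 : ∀ {p} → Prime p → 1 < p
  prime>1 {p} p-prime = nonTrivial⇒n>1 p {{prime⇒nonTrivial p-prime}}

  n<p^n : ∀ {p} → 1 < p → ∀ n → n < p ^ n
  n<p^n 1<p zero    = s≤s z≤n
  n<p^n 1<p (suc n) = ≤-<-trans (n<p^n 1<p n) (^-monoʳ-< _ 1<p (n<1+n n))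

  p^m∣p^n : ∀ p {m n} → m ≤ n → p ^ m ∣ p ^ n
  p^m∣p^n p {m} {n} m≤n =
    divides (p ^ (n ∸ m)) (trans (cong (p ^_) (sym (m∸n+n≡m m≤n))) (^-distribˡ-+-* p (n ∸ m) m))

  p^-cancelˡ-∣ : ∀ {p} .{{_ : NonZero p}} k {m z} → p ^ (k + m) ∣ p ^ k * z → p ^ m ∣ z
  p^-cancelˡ-∣ {p} k {m} p^k+m∣p^kz =
    *-cancelˡ-∣ (p ^ k) {{m^n≢0 p k}} (subst (_∣ _) (^-distribˡ-+-* p k m) p^k+m∣p^kz)

  ∥-split : ∀ {p} k {n} → p ^ k ∥ n → ∃ λ m → n ≡ p ^ k * m × p ∤ m
  ∥-split {p} k (divides m refl , p^k+1∤n) = m , *-comm m (p ^ k) , p∤m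
    where
    p∤m : p ∤ m
    p∤m (divides m′ refl) = p^k+1∤n (divides m′ (*-assoc m′ p (p ^ k)))

  p-free-part : ∀ {p} → 1 < p → ∀ {n} → 0 < n → ∃₂ λ v m → n ≡ p ^ v * m × p ∤ m
  p-free-part {p} 1<p {n} 0<n =
    let v , _ , p^v∥n = boundary (λ k → p ^ k ∣? n) n (1∣ n) p^n∤n in v , ∥-split v p^v∥n
    where
    p^n∤n : p ^ n ∤ n
    p^n∤n p^n∣n = <⇒≱ (n<p^n 1<p n) (∣⇒≤ {{>-nonZero 0<n}} p^n∣n)

  module _ {p} (p-prime : Prime p) where

    private
      instance
        p≢0 : NonZero p
        p≢0 = prime⇒nonZero p-prime

    ∤-* : ∀ {m n} → p ∤ m → p ∤ n → p ∤ m * n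
    ∤-* {m} {n} p∤m p∤n p∣mn with euclidsLemma m n p-prime p∣mn
    ... | inj₁ p∣m = p∤m p∣m
    ... | inj₂ p∣n = p∤n p∣n

    p^∣-coprime : ∀ {a} → p ∤ a → ∀ m {z} → p ^ m ∣ a * z → p ^ m ∣ z
    p^∣-coprime p∤a zero    {z} _ = 1∣ z
    p^∣-coprime {a} p∤a (suc m) {z} p^m+1∣az with euclidsLemma a z p-prime (∣-trans (m∣m*n (p ^ m)) p^m+1∣az)
    ... | inj₁ p∣a               = ⊥-elim (p∤a p∣a)
    ... | inj₂ (divides z′ refl) = subst (p ^ suc m ∣_) (*-comm p z′) (*-monoʳ-∣ p
            (p^∣-coprime p∤a m (*-cancelˡ-∣ p (subst (p ^ suc m ∣_) (regroup a z′ p) p^m+1∣az))))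
      where
      regroup : ∀ (a z p : ℕ) → a * (z * p) ≡ p * (a * z)
      regroup = solve-∀

    p^∣-*-split : ∀ E {A B} → p ^ E ∣ A * B → ∃ λ i → i ≤ E × p ^ i ∣ A × p ^ (E ∸ i) ∣ B
    p^∣-*-split zero    {A} {B} _ = 0 , z≤n , 1∣ A , 1∣ B
    p^∣-*-split (suc E) {A} {B} p^E+1∣AB with euclidsLemma A B p-prime (∣-trans (m∣m*n (p ^ E)) p^E+1∣AB)
    ... | inj₁ (divides A′ refl) =
      let i , i≤E , p^i∣A′ , p^E-i∣B = p^∣-*-split E (*-cancelˡ-∣ p (subst (p ^ suc E ∣_) (regroupˡ A′ B p) p^E+1∣AB))
      in suc i , s≤s i≤E , subst (p ^ suc i ∣_) (*-comm p A′) (*-monoʳ-∣ p p^i∣A′) , p^E-i∣B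
      where
      regroupˡ : ∀ (a b p : ℕ) → a * p * b ≡ p * (a * b)
      regroupˡ = solve-∀
    ... | inj₂ (divides B′ refl) =
      let i , i≤E , p^i∣A , p^E-i∣B′ = p^∣-*-split E (*-cancelˡ-∣ p (subst (p ^ suc E ∣_) (regroupʳ A B′ p) p^E+1∣AB))
      in i , m≤n⇒m≤1+n i≤E , p^i∣A ,
         subst₂ _∣_ (cong (p ^_) (sym (+-∸-assoc 1 i≤E))) (*-comm p B′) (*-monoʳ-∣ p p^E-i∣B′)
      where
      regroupʳ : ∀ (a b p : ℕ) → a * (b * p) ≡ p * (a * b)
      regroupʳ = solve-∀

    p^∣-*-cases : ∀ E τ {A B} → p ^ E ∣ A * B →
                  p ^ (E ∸ τ) ∣ A ⊎ p ^ (E ∸ τ) ∣ B ⊎ (2 * suc τ ≤ E × p ^ suc τ ∣ A × p ^ suc τ ∣ B)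
    p^∣-*-cases E τ p^E∣AB with p^∣-*-split E p^E∣AB
    ... | i , i≤E , p^i∣A , p^E-i∣B with E ∸ τ ≤? i | E ∸ τ ≤? E ∸ i
    ...   | yes E-τ≤i | _           = inj₁ (∣-trans (p^m∣p^n p E-τ≤i) p^i∣A)
    ...   | no  _     | yes E-τ≤E-i = inj₂ (inj₁ (∣-trans (p^m∣p^n p E-τ≤E-i) p^E-i∣B))
    ...   | no  E-τ≰i | no  E-τ≰E-i =
      inj₂ (inj₂ (2τ+2≤E , ∣-trans (p^m∣p^n p τ<i) p^i∣A , ∣-trans (p^m∣p^n p τ<E-i) p^E-i∣B))
      where
      τ<i : τ < i
      τ<i = ∸-cancelʳ-< (≰⇒> E-τ≰E-i)
      τ<E-i : τ < E ∸ i
      τ<E-i = ∸-cancelʳ-< (subst (_< E ∸ τ) (sym (m∸[m∸n]≡n i≤E)) (≰⇒> E-τ≰i))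
      2τ+2≤E : 2 * suc τ ≤ E
      2τ+2≤E = begin
        suc τ + (suc τ + 0)  ≡⟨ cong (suc τ +_) (+-identityʳ (suc τ)) ⟩
        suc τ + suc τ        ≤⟨ +-mono-≤ τ<i τ<E-i ⟩
        i + (E ∸ i)          ≡⟨ m+[n∸m]≡n i≤E ⟩
        E                    ∎
        where open ≤-Reasoning

    p^∣-cancel-p-free : ∀ {n v m} → n ≡ p ^ v * m → p ∤ m → ∀ A {z} → p ^ A ∣ n * z → p ^ (A ∸ v) ∣ z
    p^∣-cancel-p-free {v = v} {m} refl p∤m A {z} p^A∣nz with A ≤? v
    ... | yes A≤v = subst (_∣ z) (cong (p ^_) (sym (m≤n⇒m∸n≡0 A≤v))) (1∣ z)
    ... | no  A≰v = p^∣-coprime p∤m (A ∸ v) (p^-cancelˡ-∣ v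
                      (subst₂ _∣_ (cong (p ^_) (sym (m+[n∸m]≡n (≰⇒≥ A≰v)))) (*-assoc (p ^ v) m z) p^A∣nz))

    p^n-divisor : ∀ n {d} → d ∣ p ^ n → d ≡ 1 ⊎ p ∣ d
    p^n-divisor zero    d∣1 = inj₁ (∣1⇒≡1 d∣1)
    p^n-divisor (suc n) {d} d∣p^n+1 with p ∣? d
    ... | yes p∣d = inj₂ p∣d
    ... | no  p∤d = p^n-divisor n (coprime-divisor coprime d∣p^n+1)
      where
      coprime : Coprime d p
      coprime (i∣d , i∣p) with prime⇒irreducible p-prime i∣p
      ... | inj₁ i≡1  = i≡1
      ... | inj₂ refl = ⊥-elim (p∤d i∣d)

module BinaryForms where

  open import Data.Integer using (ℤ; +_; _+_; _-_; _*_; -_)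
  open import Data.Integer.Tactic.RingSolver using (solve-∀)
  open import Data.Product using (∃₂; _,_)
  open import Relation.Binary.PropositionalEquality
  open import Defs using (evalQ; discQ; resQ)

  evalQ-transpose : ∀ a b c x y → evalQ c b a y x ≡ evalQ a b c x y
  evalQ-transpose = identity
    where
    identity : ∀ (a b c x y : ℤ) →
               c * y * y + + 2 * b * y * x + a * x * x ≡ a * x * x + + 2 * b * x * y + c * y * y
    identity = solve-∀

  evalQ-scale : ∀ a b c s x y → evalQ a b c (x * s) (y * s) ≡ (s * s) * evalQ a b c x y
  evalQ-scale = identity
    where
    identity : ∀ (a b c s x y : ℤ) →
               a * (x * s) * (x * s) + + 2 * b * (x * s) * (y * s) + c * (y * s) * (y * s)
               ≡ (s * s) * (a * x * x + + 2 * b * x * y + c * y * y)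
    identity = solve-∀

  discQ-transpose : ∀ a b c → discQ c b a ≡ discQ a b c
  discQ-transpose = identity
    where
    identity : ∀ (a b c : ℤ) → + 2 * b * (+ 2 * b) - + 4 * c * a ≡ + 2 * b * (+ 2 * b) - + 4 * a * c
    identity = solve-∀

  resQ-sym : ∀ a₁ b₁ c₁ a₂ b₂ c₂ → resQ a₂ b₂ c₂ a₁ b₁ c₁ ≡ resQ a₁ b₁ c₁ a₂ b₂ c₂
  resQ-sym a₁ b₁ c₁ a₂ b₂ c₂ = identity a₁ (+ 2 * b₁) c₁ a₂ (+ 2 * b₂) c₂
    where
    identity : ∀ (a₁ B₁ c₁ a₂ B₂ c₂ : ℤ) →
               (a₂ * c₁ - a₁ * c₂) * (a₂ * c₁ - a₁ * c₂) - (a₂ * B₁ - a₁ * B₂) * (B₂ * c₁ - B₁ * c₂)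
               ≡ (a₁ * c₂ - a₂ * c₁) * (a₁ * c₂ - a₂ * c₁) - (a₁ * B₂ - a₂ * B₁) * (B₁ * c₂ - B₂ * c₁)
    identity = solve-∀

  resQ-transpose : ∀ a₁ b₁ c₁ a₂ b₂ c₂ → resQ c₁ b₁ a₁ c₂ b₂ a₂ ≡ resQ a₁ b₁ c₁ a₂ b₂ c₂
  resQ-transpose a₁ b₁ c₁ a₂ b₂ c₂ = identity a₁ (+ 2 * b₁) c₁ a₂ (+ 2 * b₂) c₂
    where
    identity : ∀ (a₁ B₁ c₁ a₂ B₂ c₂ : ℤ) →
               (c₁ * a₂ - c₂ * a₁) * (c₁ * a₂ - c₂ * a₁) - (c₁ * B₂ - c₂ * B₁) * (B₁ * a₂ - B₂ * a₁)
               ≡ (a₁ * c₂ - a₂ * c₁) * (a₁ * c₂ - a₂ * c₁) - (a₁ * B₂ - a₂ * B₁) * (B₁ * c₂ - B₂ * c₁)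
    identity = solve-∀

  -- The cofactors come from eliminating x between q₁ and q₂ (Sylvester).
  resultant-combination : ∀ a₁ b₁ c₁ a₂ b₂ c₂ x y → ∃₂ λ u v →
    (y * y * y) * resQ a₁ b₁ c₁ a₂ b₂ c₂ ≡ u * evalQ a₁ b₁ c₁ x y + v * evalQ a₂ b₂ c₂ x y
  resultant-combination a₁ b₁ c₁ a₂ b₂ c₂ x y =
    a₂ * A * x + (A * B₂ - a₂ * C) * y , - (a₁ * A) * x + (a₁ * C - B₁ * A) * y , identity a₁ B₁ c₁ a₂ B₂ c₂ x y
    where
    B₁ = + 2 * b₁
    B₂ = + 2 * b₂
    A = a₁ * B₂ - a₂ * B₁
    C = a₁ * c₂ - a₂ * c₁
    identity : ∀ (a₁ B₁ c₁ a₂ B₂ c₂ x y : ℤ) →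
      (y * y * y) * ((a₁ * c₂ - a₂ * c₁) * (a₁ * c₂ - a₂ * c₁) - (a₁ * B₂ - a₂ * B₁) * (B₁ * c₂ - B₂ * c₁))
      ≡ (a₂ * (a₁ * B₂ - a₂ * B₁) * x + ((a₁ * B₂ - a₂ * B₁) * B₂ - a₂ * (a₁ * c₂ - a₂ * c₁)) * y)
          * (a₁ * x * x + B₁ * x * y + c₁ * y * y)
        + (- (a₁ * (a₁ * B₂ - a₂ * B₁)) * x + (a₁ * (a₁ * c₂ - a₂ * c₁) - B₁ * (a₁ * B₂ - a₂ * B₁)) * y)
          * (a₂ * x * x + B₂ * x * y + c₂ * y * y)
    identity = solve-∀

  -- ∂q/∂y; completing the square in y gives (∂q/∂y)² − 4cq = δx².
  ∂yQ : ℤ → ℤ → ℤ → ℤ → ℤ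
  ∂yQ b c x y = + 2 * c * y + + 2 * b * x

  evalQ-difference : ∀ a b c x y y′ → evalQ a b c x y - evalQ a b c x y′ ≡ (y - y′) * (c * (y + y′) + + 2 * b * x)
  evalQ-difference a b c x y y′ = identity a (+ 2 * b) c x y y′
    where
    identity : ∀ (a B c x y y′ : ℤ) →
               (a * x * x + B * x * y + c * y * y) - (a * x * x + B * x * y′ + c * y′ * y′)
               ≡ (y - y′) * (c * (y + y′) + B * x)
    identity = solve-∀

  evalQ-difference-∂yQ : ∀ a b c x y y′ →
    + 4 * c * evalQ a b c x y - + 4 * c * evalQ a b c x y′ ≡ (∂yQ b c x y - ∂yQ b c x y′) * (∂yQ b c x y + ∂yQ b c x y′)
  evalQ-difference-∂yQ a b c x y y′ = identity a (+ 2 * b) c x y y′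
    where
    identity : ∀ (a B c x y y′ : ℤ) →
      + 4 * c * (a * x * x + B * x * y + c * y * y) - + 4 * c * (a * x * x + B * x * y′ + c * y′ * y′)
      ≡ ((+ 2 * c * y + B * x) - (+ 2 * c * y′ + B * x)) * ((+ 2 * c * y + B * x) + (+ 2 * c * y′ + B * x))
    identity = solve-∀

  ∂yQ-difference : ∀ b c x y y′ → ∂yQ b c x y - ∂yQ b c x y′ ≡ + 2 * c * (y - y′)
  ∂yQ-difference b c x y y′ = identity (+ 2 * b) c x y y′
    where
    identity : ∀ (B c x y y′ : ℤ) → (+ 2 * c * y + B * x) - (+ 2 * c * y′ + B * x) ≡ + 2 * c * (y - y′)
    identity = solve-∀

  ∂yQ-discriminant : ∀ a b c x y →
    (+ 2 * ∂yQ b c x y) * (+ 2 * ∂yQ b c x y) - + 16 * c * evalQ a b c x y ≡ (x * x) * (+ 4 * discQ a b c)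
  ∂yQ-discriminant a b c x y = identity a (+ 2 * b) c x y
    where
    identity : ∀ (a B c x y : ℤ) →
      (+ 2 * (+ 2 * c * y + B * x)) * (+ 2 * (+ 2 * c * y + B * x)) - + 16 * c * (a * x * x + B * x * y + c * y * y)
      ≡ (x * x) * (+ 4 * (B * B - + 4 * a * c))
    identity = solve-∀

module Zeros where

  open import Data.Nat using (ℕ; zero; suc; _+_; _*_; _∸_; _^_; _≤_; _<_; >-nonZero)
  open import Data.Nat.Properties
  open import Data.Nat.Divisibility using (_∣_; _∤_; divides; _∣?_; ∣⇒≤)
  open import Data.Nat.Primality using (Prime; prime⇒nonZero)
  open import Data.Integer as ℤ using (ℤ; +_)
  import Data.Integer.Properties as ℤ
  open import Data.Product using (_×_; _,_; ∃₂)
  open import Data.Empty using (⊥-elim)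
  open import Relation.Nullary using (¬_; yes; no)
  open import Relation.Unary using (Pred; Decidable)
  open import Relation.Binary.PropositionalEquality

  open import Defs using (evalQ; resQ)
  open PrimePowers
  open Congruences using (_∣ℤ_; ∣ℤ-+; ∣ℤ-*ˡ)
  open BinaryForms

  Root : ℤ → ℤ → ℤ → ℕ → ℕ → Pred ℕ _
  Root a b c n x y = n ∣ℤ evalQ a b c (+ x) (+ y)

  root? : ∀ a b c n x → Decidable (Root a b c n x)
  root? a b c n x y = n ∣? ℤ.∣ evalQ a b c (+ x) (+ y) ∣

  Root-multiples : ∀ a b c {n x y} → n ∣ x → n ∣ y → Root a b c n x y
  Root-multiples a b c {n} {x} {y} n∣x n∣y =
    ∣ℤ-+ (ax² ℤ.+ 2bxy) (c ℤ.* + y ℤ.* + y)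
         (∣ℤ-+ ax² 2bxy (∣ℤ-*ˡ (a ℤ.* + x) (+ x) n∣x) (∣ℤ-*ˡ (+ 2 ℤ.* b ℤ.* + x) (+ y) n∣y))
         (∣ℤ-*ˡ (c ℤ.* + y) (+ y) n∣y)
    where
    ax² = a ℤ.* + x ℤ.* + x
    2bxy = + 2 ℤ.* b ℤ.* + x ℤ.* + y

  Root-transpose : ∀ a b c {n x y} → Root a b c n x y → Root c b a n y x
  Root-transpose a b c {n} {x} {y} = subst (λ q → n ∣ ℤ.∣ q ∣) (sym (evalQ-transpose a b c (+ x) (+ y)))

  ∣cube*∣ : ∀ y r → ℤ.∣ (+ y ℤ.* + y ℤ.* + y) ℤ.* r ∣ ≡ y * y * y * ℤ.∣ r ∣
  ∣cube*∣ y r = trans (ℤ.abs-* (+ y ℤ.* + y ℤ.* + y) r)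
    (cong (_* ℤ.∣ r ∣) (trans (ℤ.abs-* (+ y ℤ.* + y) (+ y)) (cong (_* y) (ℤ.abs-* (+ y) (+ y)))))

  module _ {p} (p-prime : Prime p) where

    resultant-divisible-y : ∀ a₁ b₁ c₁ a₂ b₂ c₂ m {x y} → p ∤ y →
      Root a₁ b₁ c₁ (p ^ m) x y → Root a₂ b₂ c₂ (p ^ m) x y → p ^ m ∣ ℤ.∣ resQ a₁ b₁ c₁ a₂ b₂ c₂ ∣
    resultant-divisible-y a₁ b₁ c₁ a₂ b₂ c₂ m {x} {y} p∤y q₁≡0 q₂≡0 =
      p^∣-coprime p-prime (∤-* p-prime (∤-* p-prime p∤y p∤y) p∤y) m
        (subst (p ^ m ∣_) (∣cube*∣ y (resQ a₁ b₁ c₁ a₂ b₂ c₂))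
               (combination (resultant-combination a₁ b₁ c₁ a₂ b₂ c₂ (+ x) (+ y))))
      where
      q₁ = evalQ a₁ b₁ c₁ (+ x) (+ y)
      q₂ = evalQ a₂ b₂ c₂ (+ x) (+ y)
      y³Res = (+ y ℤ.* + y ℤ.* + y) ℤ.* resQ a₁ b₁ c₁ a₂ b₂ c₂
      combination : (∃₂ λ u v → y³Res ≡ u ℤ.* q₁ ℤ.+ v ℤ.* q₂) → p ^ m ∣ℤ y³Res
      combination (u , v , y³Res≡uq₁+vq₂) =
        subst (p ^ m ∣ℤ_) (sym y³Res≡uq₁+vq₂) (∣ℤ-+ (u ℤ.* q₁) (v ℤ.* q₂) (∣ℤ-*ˡ u q₁ q₁≡0) (∣ℤ-*ˡ v q₂ q₂≡0))

    resultant-divisible : ∀ a₁ b₁ c₁ a₂ b₂ c₂ m {x y} → ¬ (p ∣ x × p ∣ y) →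
      Root a₁ b₁ c₁ (p ^ m) x y → Root a₂ b₂ c₂ (p ^ m) x y → p ^ m ∣ ℤ.∣ resQ a₁ b₁ c₁ a₂ b₂ c₂ ∣
    resultant-divisible a₁ b₁ c₁ a₂ b₂ c₂ m {x} {y} ¬p∣x,y q₁≡0 q₂≡0 with p ∣? x | p ∣? y
    ... | _       | no p∤y  = resultant-divisible-y a₁ b₁ c₁ a₂ b₂ c₂ m p∤y q₁≡0 q₂≡0
    ... | yes p∣x | yes p∣y = ⊥-elim (¬p∣x,y (p∣x , p∣y))
    ... | no p∤x  | yes _   = subst (λ r → p ^ m ∣ ℤ.∣ r ∣) (resQ-transpose a₁ b₁ c₁ a₂ b₂ c₂)
      (resultant-divisible-y c₁ b₁ a₁ c₂ b₂ a₂ m p∤x (Root-transpose a₁ b₁ c₁ q₁≡0) (Root-transpose a₂ b₂ c₂ q₂≡0))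

    -- Dividing x and y by p^k leaves a common zero modulo p^(F − 2k) with a coordinate prime to p,
    -- so p^(F − 2k) divides the resultant.
    common-zero-bound : ∀ a₁ b₁ c₁ a₂ b₂ c₂ {F k x y} → 0 < ℤ.∣ resQ a₁ b₁ c₁ a₂ b₂ c₂ ∣ →
      p ^ k ∣ x → p ^ k ∣ y → ¬ (p ^ suc k ∣ x × p ^ suc k ∣ y) →
      Root a₁ b₁ c₁ (p ^ F) x y → Root a₂ b₂ c₂ (p ^ F) x y → F < (k + k) + ℤ.∣ resQ a₁ b₁ c₁ a₂ b₂ c₂ ∣
    common-zero-bound a₁ b₁ c₁ a₂ b₂ c₂ {F} {k} 0<Res (divides x′ refl) (divides y′ refl) ¬p^k+1∣x,y q₁≡0 q₂≡0
      with F ≤? k + k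
    ... | yes F≤2k = ≤-<-trans F≤2k (m<m+n (k + k) 0<Res)
    ... | no  F≰2k =
      subst (_< (k + k) + Res) 2k+m≡F (+-monoʳ-< (k + k) (<-≤-trans (n<p^n (prime>1 p-prime) m) p^m≤Res))
      where
      Res = ℤ.∣ resQ a₁ b₁ c₁ a₂ b₂ c₂ ∣
      m = F ∸ (k + k)
      2k+m≡F : (k + k) + m ≡ F
      2k+m≡F = m+[n∸m]≡n (<⇒≤ (≰⇒> F≰2k))
      descend : ∀ a b c → Root a b c (p ^ F) (x′ * p ^ k) (y′ * p ^ k) → Root a b c (p ^ m) x′ y′
      descend a b c p^F∣q =
        p^-cancelˡ-∣ {{prime⇒nonZero p-prime}} (k + k) (subst₂ _∣_ (cong (p ^_) (sym 2k+m≡F)) ∣q∣≡ p^F∣q)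
        where
        P = + (p ^ k)
        ∣q∣≡ : ℤ.∣ evalQ a b c (+ (x′ * p ^ k)) (+ (y′ * p ^ k)) ∣ ≡ p ^ (k + k) * ℤ.∣ evalQ a b c (+ x′) (+ y′) ∣
        ∣q∣≡ = begin
          ℤ.∣ evalQ a b c (+ (x′ * p ^ k)) (+ (y′ * p ^ k)) ∣  ≡⟨ cong ℤ.∣_∣ (cong₂ (evalQ a b c) (ℤ.pos-* x′ (p ^ k)) (ℤ.pos-* y′ (p ^ k))) ⟩
          ℤ.∣ evalQ a b c (+ x′ ℤ.* P) (+ y′ ℤ.* P) ∣          ≡⟨ cong ℤ.∣_∣ (evalQ-scale a b c P (+ x′) (+ y′)) ⟩
          ℤ.∣ (P ℤ.* P) ℤ.* evalQ a b c (+ x′) (+ y′) ∣        ≡⟨ ℤ.abs-* (P ℤ.* P) _ ⟩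
          ℤ.∣ P ℤ.* P ∣ * ℤ.∣ evalQ a b c (+ x′) (+ y′) ∣      ≡⟨ cong (_* _) (trans (ℤ.abs-* P P) (sym (^-distribˡ-+-* p k k))) ⟩
          p ^ (k + k) * ℤ.∣ evalQ a b c (+ x′) (+ y′) ∣        ∎
          where open ≡-Reasoning
      ¬p∣x′,y′ : ¬ (p ∣ x′ × p ∣ y′)
      ¬p∣x′,y′ (divides x″ refl , divides y″ refl) =
        ¬p^k+1∣x,y (divides x″ (*-assoc x″ p (p ^ k)) , divides y″ (*-assoc y″ p (p ^ k)))
      p^m≤Res : p ^ m ≤ Res
      p^m≤Res = ∣⇒≤ {{>-nonZero 0<Res}}
        (resultant-divisible a₁ b₁ c₁ a₂ b₂ c₂ m ¬p∣x′,y′ (descend a₁ b₁ c₁ q₁≡0) (descend a₂ b₂ c₂ q₂≡0))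

module RowCounts where

  open import Data.Nat using (ℕ; zero; suc; _+_; _*_; _∸_; _^_; _≤_; _<_; z<s; NonZero)
  open import Data.Nat.Properties
  open import Data.Nat.Divisibility using (_∣_; _∤_; _∣?_; ∣-trans; m∣m*n; _∣0)
  open import Data.Nat.Primality using (Prime; euclidsLemma; prime⇒nonZero)
  open import Data.Nat.Tactic.RingSolver using (solve-∀)
  open import Data.Integer as ℤ using (ℤ; +_)
  import Data.Integer.Properties as ℤ
  import Data.Integer.Tactic.RingSolver as ℤ-Solver
  open import Data.Product using (_×_; _,_; ∃; ∃₂)
  open import Data.Sum as Sum using (_⊎_; inj₁; inj₂; [_,_]′)
  open import Data.Empty using (⊥-elim)
  open import Relation.Nullary using (¬_)
  open import Relation.Unary using (Decidable)
  open import Relation.Binary.PropositionalEquality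

  open import Defs using (evalQ; discQ)
  open Counting
  open Congruences
  open PrimePowers
  open BinaryForms
  open Zeros

  module _ {p} (p-prime : Prime p) (a b c : ℤ) where

    private
      instance
        p≢0 : NonZero p
        p≢0 = prime⇒nonZero p-prime

      0<p : 0 < p
      0<p = <-trans z<s (prime>1 p-prime)

    count-roots-mod-p : p ∤ ℤ.∣ c ∣ → ∀ x → count (root? a b c p x) 0 p ≤ 2
    count-roots-mod-p p∤c x = subst (λ N → count (root? a b c p x) 0 N ≤ 2) (+-identityʳ p)
      (count-two-classes 0<p (root? a b c p x) 1 (λ y₁ y → p ∣? ℤ.∣ secant y₁ y ∣) split secant-congruent)
      where
      secant : ℕ → ℕ → ℤ
      secant y₁ y = c ℤ.* (+ y ℤ.+ + y₁) ℤ.+ + 2 ℤ.* b ℤ.* + x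
      split : ∀ {y₁ y} → Root a b c p x y₁ → Root a b c p x y → y ≡ y₁ [mod p ] ⊎ p ∣ℤ secant y₁ y
      split {y₁} {y} q₁≡0 q≡0 = Sum.map₁ modulus∣ (euclidsLemma _ _ p-prime
        (subst (p ∣_) (trans (cong ℤ.∣_∣ (evalQ-difference a b c (+ x) (+ y) (+ y₁))) (ℤ.abs-* (+ y ℤ.- + y₁) (secant y₁ y)))
               (∣ℤ-- (evalQ a b c (+ x) (+ y)) (evalQ a b c (+ x) (+ y₁)) q≡0 q₁≡0)))
      secant-congruent : ∀ {y₁ y y′} → p ∣ℤ secant y₁ y → p ∣ℤ secant y₁ y′ → y ≡ y′ [mod p ]
      secant-congruent {y₁} {y} {y′} p∣s p∣s′ = [ (λ p∣c → ⊥-elim (p∤c p∣c)) , modulus∣ ]′ (euclidsLemma ℤ.∣ c ∣ _ p-prime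
        (subst (p ∣_) (trans (cong ℤ.∣_∣ (identity c (+ y) (+ y′) (+ y₁) (+ 2 ℤ.* b ℤ.* + x))) (ℤ.abs-* c (+ y ℤ.- + y′)))
               (∣ℤ-- (secant y₁ y) (secant y₁ y′) p∣s p∣s′)))
        where
        identity : ∀ (c y y′ y₁ t : ℤ) → (c ℤ.* (y ℤ.+ y₁) ℤ.+ t) ℤ.- (c ℤ.* (y′ ℤ.+ y₁) ℤ.+ t) ≡ c ℤ.* (y ℤ.- y′)
        identity = ℤ-Solver.solve-∀

    private
      ∣4δ∣ = ℤ.∣ + 4 ℤ.* discQ a b c ∣
      ∣2c∣ = ℤ.∣ + 2 ℤ.* c ∣

      w : ℕ → ℕ → ℤ
      w x y = ∂yQ b c (+ x) (+ y)

    -- (2w)² − 16cq = 4δx² = p^(2k+T) x′² δ′ with p ∤ x′δ′, so at a root modulo p^(2(k+T+1))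
    -- the value 2w cannot be divisible by p^(k+T+1).
    ¬lifted-double-root : ∀ {k T x x′ δ′ y₁} → x ≡ p ^ k * x′ → p ∤ x′ → ∣4δ∣ ≡ p ^ T * δ′ → p ∤ δ′ →
                          Root a b c (p ^ (2 * suc (k + T))) x y₁ → ¬ p ^ suc (k + T) ∣ℤ + 2 ℤ.* w x y₁
    ¬lifted-double-root {k} {T} {x} {x′} {δ′} {y₁} refl p∤x′ ∣4δ∣≡ p∤δ′ q≡0 p^σ∣2w =
      ∤-* p-prime (∤-* p-prime p∤x′ p∤x′) p∤δ′ (∣-trans (m∣m*n (p ^ suc T))
        (p^-cancelˡ-∣ (k + k + T) (subst₂ _∣_ (cong (p ^_) 2σ≡) ∣x²4δ∣≡ p^2σ∣x²4δ)))
      where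
      σ = suc (k + T)
      2w = + 2 ℤ.* w x y₁
      p^2σ∣x²4δ : p ^ (2 * σ) ∣ℤ (+ x ℤ.* + x) ℤ.* (+ 4 ℤ.* discQ a b c)
      p^2σ∣x²4δ = subst (p ^ (2 * σ) ∣ℤ_) (∂yQ-discriminant a b c (+ x) (+ y₁))
        (∣ℤ-- (2w ℤ.* 2w) _ (subst (_∣ℤ 2w ℤ.* 2w) p^σ*p^σ (∣ℤ-* 2w 2w p^σ∣2w p^σ∣2w)) (∣ℤ-*ˡ (+ 16 ℤ.* c) _ q≡0))
        where
        p^σ*p^σ : p ^ σ * p ^ σ ≡ p ^ (2 * σ)
        p^σ*p^σ = trans (sym (^-distribˡ-+-* p σ σ)) (cong (λ e → p ^ (σ + e)) (sym (+-identityʳ σ)))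
      2σ≡ : 2 * σ ≡ (k + k + T) + suc (suc T)
      2σ≡ = identity k T
        where
        identity : ∀ (k T : ℕ) → 2 * suc (k + T) ≡ (k + k + T) + suc (suc T)
        identity = solve-∀
      ∣x²4δ∣≡ : ℤ.∣ (+ x ℤ.* + x) ℤ.* (+ 4 ℤ.* discQ a b c) ∣ ≡ p ^ (k + k + T) * (x′ * x′ * δ′)
      ∣x²4δ∣≡ = begin
        ℤ.∣ (+ x ℤ.* + x) ℤ.* (+ 4 ℤ.* discQ a b c) ∣  ≡⟨ ℤ.abs-* (+ x ℤ.* + x) _ ⟩
        ℤ.∣ + x ℤ.* + x ∣ * ∣4δ∣                       ≡⟨ cong₂ _*_ (ℤ.abs-* (+ x) (+ x)) ∣4δ∣≡ ⟩
        p ^ k * x′ * (p ^ k * x′) * (p ^ T * δ′)       ≡⟨ regroup (p ^ k) x′ (p ^ T) δ′ ⟩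
        p ^ k * p ^ k * p ^ T * (x′ * x′ * δ′)         ≡⟨ cong (_* _) p^k*p^k*p^T ⟩
        p ^ (k + k + T) * (x′ * x′ * δ′)               ∎
        where
        open ≡-Reasoning
        regroup : ∀ (P X Q D : ℕ) → P * X * (P * X) * (Q * D) ≡ P * P * Q * (X * X * D)
        regroup = solve-∀
        p^k*p^k*p^T : p ^ k * p ^ k * p ^ T ≡ p ^ (k + k + T)
        p^k*p^k*p^T = trans (cong (_* p ^ T) (sym (^-distribˡ-+-* p k k))) (sym (^-distribˡ-+-* p (k + k) T))

    roots-dichotomy : ∀ {E k T x x′ δ′ y₁ y} → x ≡ p ^ k * x′ → p ∤ x′ → ∣4δ∣ ≡ p ^ T * δ′ → p ∤ δ′ →
                      Root a b c (p ^ E) x y₁ → Root a b c (p ^ E) x y →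
                      p ^ (E ∸ (k + T)) ∣ℤ w x y ℤ.- w x y₁ ⊎ p ^ (E ∸ (k + T)) ∣ℤ w x y ℤ.+ w x y₁
    roots-dichotomy {E} {k} {T} {x} {y₁ = y₁} {y} x≡ p∤x′ ∣4δ∣≡ p∤δ′ q₁≡0 q≡0 =
      cases (p^∣-*-cases p-prime E τ (subst (p ^ E ∣_) (ℤ.abs-* (w x y ℤ.- w x y₁) (w x y ℤ.+ w x y₁)) p^E∣w²-w₁²))
      where
      τ = k + T
      q = evalQ a b c (+ x) (+ y)
      q₁ = evalQ a b c (+ x) (+ y₁)
      p^E∣w²-w₁² : p ^ E ∣ℤ (w x y ℤ.- w x y₁) ℤ.* (w x y ℤ.+ w x y₁)
      p^E∣w²-w₁² = subst (p ^ E ∣ℤ_) (evalQ-difference-∂yQ a b c (+ x) (+ y) (+ y₁))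
        (∣ℤ-- (+ 4 ℤ.* c ℤ.* q) (+ 4 ℤ.* c ℤ.* q₁) (∣ℤ-*ˡ (+ 4 ℤ.* c) q q≡0) (∣ℤ-*ˡ (+ 4 ℤ.* c) q₁ q₁≡0))
      identity : ∀ (u v : ℤ) → (u ℤ.+ v) ℤ.- (u ℤ.- v) ≡ + 2 ℤ.* v
      identity = ℤ-Solver.solve-∀
      cases : p ^ (E ∸ τ) ∣ℤ w x y ℤ.- w x y₁ ⊎ p ^ (E ∸ τ) ∣ℤ w x y ℤ.+ w x y₁ ⊎
                (2 * suc τ ≤ E × p ^ suc τ ∣ℤ w x y ℤ.- w x y₁ × p ^ suc τ ∣ℤ w x y ℤ.+ w x y₁) →
              p ^ (E ∸ τ) ∣ℤ w x y ℤ.- w x y₁ ⊎ p ^ (E ∸ τ) ∣ℤ w x y ℤ.+ w x y₁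
      cases (inj₁ p^ν∣w-w₁)        = inj₁ p^ν∣w-w₁
      cases (inj₂ (inj₁ p^ν∣w+w₁)) = inj₂ p^ν∣w+w₁
      cases (inj₂ (inj₂ (2σ≤E , p^σ∣w-w₁ , p^σ∣w+w₁))) =
        ⊥-elim (¬lifted-double-root {k} {T} x≡ p∤x′ ∣4δ∣≡ p∤δ′ (∣-trans (p^m∣p^n p 2σ≤E) q₁≡0)
          (subst (p ^ suc τ ∣ℤ_) (identity (w x y) (w x y₁))
            (∣ℤ-- (w x y ℤ.+ w x y₁) (w x y ℤ.- w x y₁) p^σ∣w+w₁ p^σ∣w-w₁)))

    private
      exponent-bound : ∀ {S E k T j} → E ≤ S → S ∸ ((E ∸ (k + T)) ∸ j) ≤ (S ∸ E) + k + (T + j)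
      exponent-bound {S} {E} {k} {T} {j} E≤S = m≤n+o⇒m∸n≤o S μ (begin
        S                                ≡⟨ m∸n+n≡m E≤S ⟨
        (S ∸ E) + E                      ≤⟨ +-monoʳ-≤ (S ∸ E) (m≤n+m∸n E (k + T)) ⟩
        (S ∸ E) + ((k + T) + ν)          ≤⟨ +-monoʳ-≤ (S ∸ E) (+-monoʳ-≤ (k + T) (m≤n+m∸n ν j)) ⟩
        (S ∸ E) + ((k + T) + (j + μ))    ≡⟨ regroup (S ∸ E) k T j μ ⟩
        μ + ((S ∸ E) + k + (T + j))      ∎)
        where
        open ≤-Reasoning
        ν = E ∸ (k + T)
        μ = ν ∸ j
        regroup : ∀ (A k T j μ : ℕ) → A + ((k + T) + (j + μ)) ≡ μ + (A + k + (T + j))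
        regroup = solve-∀

      p^v≤n : ∀ {n v m} → n ≡ p ^ v * m → p ∤ m → p ^ v ≤ n
      p^v≤n {v = v} {zero}  _    p∤0 = ⊥-elim (p∤0 (p ∣0))
      p^v≤n {v = v} {suc m} refl _   = m≤m*n (p ^ v) (suc m)

      -- Relative to one root y₁, every root y has p^ν ∣ 2c(y − y₁) or p^ν ∣ w(y) + w(y₁)
      -- (roots-dichotomy), so the roots fill at most two classes modulo p^(ν − v_p(2c)).
      count-roots-by-valuations : ∀ {E S k T j x x′ δ′ c′} → E ≤ S → x ≡ p ^ k * x′ → p ∤ x′ →
        ∣4δ∣ ≡ p ^ T * δ′ → p ∤ δ′ → ∣2c∣ ≡ p ^ j * c′ → p ∤ c′ →
        count (root? a b c (p ^ E) x) 0 (p ^ S) ≤ 2 * (p ^ ((S ∸ E) + k) * (∣4δ∣ * ∣2c∣))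
      count-roots-by-valuations {E} {S} {k} {T} {j} {x} E≤S x≡ p∤x′ ∣4δ∣≡ p∤δ′ ∣2c∣≡ p∤c′ = begin
        count roots 0 (p ^ S)                        ≡⟨ cong (count roots 0) p^S≡ ⟩
        count roots 0 (p ^ (S ∸ μ) * p ^ μ)          ≤⟨ count-two-classes 0<p^μ roots (p ^ (S ∸ μ)) R? split R-congruent ⟩
        2 * p ^ (S ∸ μ)                              ≤⟨ *-monoʳ-≤ 2 p^[S-μ]≤ ⟩
        2 * (p ^ ((S ∸ E) + k) * (∣4δ∣ * ∣2c∣))       ∎
        where
        open ≤-Reasoning
        roots = root? a b c (p ^ E) x
        ν = E ∸ (k + T)
        μ = ν ∸ j
        0<p^μ : 0 < p ^ μ
        0<p^μ = m^n>0 p μ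
        p^S≡ : p ^ S ≡ p ^ (S ∸ μ) * p ^ μ
        p^S≡ = trans (cong (p ^_) (sym (m∸n+n≡m μ≤S))) (^-distribˡ-+-* p (S ∸ μ) μ)
          where μ≤S = ≤-trans (m∸n≤m ν j) (≤-trans (m∸n≤m E (k + T)) E≤S)
        R? : ∀ y₁ → Decidable (λ y → p ^ ν ∣ℤ w x y ℤ.+ w x y₁)
        R? y₁ y = p ^ ν ∣? ℤ.∣ w x y ℤ.+ w x y₁ ∣
        cancel-2c : ∀ {y y′} → p ^ ν ∣ℤ w x y ℤ.- w x y′ → y ≡ y′ [mod p ^ μ ]
        cancel-2c {y} {y′} p^ν∣w-w′ = modulus∣ (p^∣-cancel-p-free p-prime {v = j} ∣2c∣≡ p∤c′ ν
          (subst (p ^ ν ∣_) (trans (cong ℤ.∣_∣ (∂yQ-difference b c (+ x) (+ y) (+ y′))) (ℤ.abs-* (+ 2 ℤ.* c) (+ y ℤ.- + y′)))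
                 p^ν∣w-w′))
        split : ∀ {y₁ y} → Root a b c (p ^ E) x y₁ → Root a b c (p ^ E) x y →
                y ≡ y₁ [mod p ^ μ ] ⊎ p ^ ν ∣ℤ w x y ℤ.+ w x y₁
        split q₁≡0 q≡0 = Sum.map₁ cancel-2c (roots-dichotomy {k = k} {T} x≡ p∤x′ ∣4δ∣≡ p∤δ′ q₁≡0 q≡0)
        R-congruent : ∀ {y₁ y y′} → p ^ ν ∣ℤ w x y ℤ.+ w x y₁ → p ^ ν ∣ℤ w x y′ ℤ.+ w x y₁ → y ≡ y′ [mod p ^ μ ]
        R-congruent {y₁} {y} {y′} p^ν∣w+w₁ p^ν∣w′+w₁ = cancel-2c
          (subst (p ^ ν ∣ℤ_) (identity (w x y) (w x y′) (w x y₁))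
                 (∣ℤ-- (w x y ℤ.+ w x y₁) (w x y′ ℤ.+ w x y₁) p^ν∣w+w₁ p^ν∣w′+w₁))
          where
          identity : ∀ (u v t : ℤ) → (u ℤ.+ t) ℤ.- (v ℤ.+ t) ≡ u ℤ.- v
          identity = ℤ-Solver.solve-∀
        p^[S-μ]≤ : p ^ (S ∸ μ) ≤ p ^ ((S ∸ E) + k) * (∣4δ∣ * ∣2c∣)
        p^[S-μ]≤ = begin
          p ^ (S ∸ μ)                          ≤⟨ ^-monoʳ-≤ p (exponent-bound {S} {E} {k} {T} {j} E≤S) ⟩
          p ^ ((S ∸ E) + k + (T + j))          ≡⟨ ^-distribˡ-+-* p ((S ∸ E) + k) (T + j) ⟩
          p ^ ((S ∸ E) + k) * p ^ (T + j)      ≡⟨ cong (p ^ ((S ∸ E) + k) *_) (^-distribˡ-+-* p T j) ⟩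
          p ^ ((S ∸ E) + k) * (p ^ T * p ^ j)  ≤⟨ *-monoʳ-≤ (p ^ ((S ∸ E) + k)) (*-mono-≤ (p^v≤n {v = T} ∣4δ∣≡ p∤δ′) (p^v≤n {v = j} ∣2c∣≡ p∤c′)) ⟩
          p ^ ((S ∸ E) + k) * (∣4δ∣ * ∣2c∣)    ∎

    count-roots-row : ∀ {E S k x} → 0 < ℤ.∣ c ∣ → 0 < ℤ.∣ discQ a b c ∣ → E ≤ S → p ^ k ∥ x →
                      count (root? a b c (p ^ E) x) 0 (p ^ S) ≤ 16 * (ℤ.∣ discQ a b c ∣ * ℤ.∣ c ∣) * p ^ ((S ∸ E) + k)
    count-roots-row {E} {S} {k} {x} 0<∣c∣ 0<∣δ∣ E≤S p^k∥x = begin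
      count (root? a b c (p ^ E) x) 0 (p ^ S)                           ≤⟨ by-valuations (∥-split k p^k∥x) (p-free-part 1<p 0<∣4δ∣) (p-free-part 1<p 0<∣2c∣) ⟩
      2 * (p ^ ((S ∸ E) + k) * (∣4δ∣ * ∣2c∣))                            ≡⟨ cong₂ (λ u v → 2 * (p ^ ((S ∸ E) + k) * (u * v))) (ℤ.abs-* (+ 4) (discQ a b c)) (ℤ.abs-* (+ 2) c) ⟩
      2 * (p ^ ((S ∸ E) + k) * (4 * ℤ.∣ discQ a b c ∣ * (2 * ℤ.∣ c ∣)))  ≡⟨ regroup (p ^ ((S ∸ E) + k)) ℤ.∣ discQ a b c ∣ ℤ.∣ c ∣ ⟩
      16 * (ℤ.∣ discQ a b c ∣ * ℤ.∣ c ∣) * p ^ ((S ∸ E) + k)            ∎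
      where
      open ≤-Reasoning
      1<p = prime>1 p-prime
      0<∣4δ∣ : 0 < ∣4δ∣
      0<∣4δ∣ = subst (0 <_) (sym (ℤ.abs-* (+ 4) (discQ a b c))) (*-monoʳ-< 4 0<∣δ∣)
      0<∣2c∣ : 0 < ∣2c∣
      0<∣2c∣ = subst (0 <_) (sym (ℤ.abs-* (+ 2) c)) (*-monoʳ-< 2 0<∣c∣)
      by-valuations : (∃ λ x′ → x ≡ p ^ k * x′ × p ∤ x′) → (∃₂ λ T δ′ → ∣4δ∣ ≡ p ^ T * δ′ × p ∤ δ′) →
                      (∃₂ λ j c′ → ∣2c∣ ≡ p ^ j * c′ × p ∤ c′) →
                      count (root? a b c (p ^ E) x) 0 (p ^ S) ≤ 2 * (p ^ ((S ∸ E) + k) * (∣4δ∣ * ∣2c∣))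
      by-valuations (x′ , x≡ , p∤x′) (T , δ′ , ∣4δ∣≡ , p∤δ′) (j , c′ , ∣2c∣≡ , p∤c′) =
        count-roots-by-valuations {T = T} {j} E≤S x≡ p∤x′ ∣4δ∣≡ p∤δ′ ∣2c∣≡ p∤c′
      regroup : ∀ (P d c : ℕ) → 2 * (P * (4 * d * (2 * c))) ≡ 16 * (d * c) * P
      regroup = solve-∀

module PairCounts where

  open import Data.Nat using (ℕ; suc; _+_; _*_; _∸_; _^_; _≤_; _<_; z≤n; s≤s; z<s; NonZero; >-nonZero; ⌈_/2⌉; ⌊_/2⌋)
  open import Data.Nat.Properties
  open import Data.Nat.Divisibility using (_∣_; _∤_; _∣?_; ∣-trans; 1∣_)
  open import Data.Nat.Primality using (Prime; prime⇒nonZero)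
  open import Data.Nat.Tactic.RingSolver using (solve-∀)
  open import Data.Integer as ℤ using (ℤ)
  open import Data.Product using (_×_; _,_; ∃; proj₁; proj₂)
  open import Data.Sum using (_⊎_; inj₁; inj₂)
  open import Relation.Nullary using (¬_; Dec; yes; no)
  open import Relation.Nullary.Decidable using (_×-dec_)
  open import Relation.Unary using (Pred; Decidable)
  open import Relation.Binary.PropositionalEquality

  open import Defs using (discQ; resQ)
  open Counting
  open Congruences using (count-multiples)
  open PrimePowers
  open BinaryForms using (discQ-transpose)
  open Zeros
  open RowCounts

  private
    ⌈E/2⌉-bounds : ∀ E → E ≤ ⌈ E /2⌉ + ⌈ E /2⌉ × ⌈ E /2⌉ + ⌈ E /2⌉ ≤ suc E
    ⌈E/2⌉-bounds E =
      ≤-trans (≤-reflexive (sym (⌊n/2⌋+⌈n/2⌉≡n E))) (+-monoˡ-≤ ⌈ E /2⌉ (⌊n/2⌋≤⌈n/2⌉ E)) ,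
      ≤-trans (+-monoʳ-≤ ⌈ E /2⌉ (⌊n/2⌋≤⌈n/2⌉ (suc E))) (≤-reflexive (⌊n/2⌋+⌈n/2⌉≡n (suc E)))

    level-range : ∀ {E F L H k} → F ≤ E → H + H ≤ suc E → k < H → F < (k + k) + L →
                  F ∸ (L + H) ≤ k × k < (F ∸ (L + H)) + suc ((E ∸ F) + L)
    level-range {E} {F} {L} {H} {k} F≤E 2H≤E+1 k<H F<2k+L = lower , upper
      where
      open ≤-Reasoning
      lower : F ∸ (L + H) ≤ k
      lower = m≤n+o⇒m∸n≤o F (L + H) (begin
        F               ≤⟨ <⇒≤ F<2k+L ⟩
        k + k + L       ≤⟨ +-monoˡ-≤ L (+-monoʳ-≤ k (<⇒≤ k<H)) ⟩
        k + H + L       ≡⟨ regroup k H L ⟩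
        L + H + k       ∎)
        where
        regroup : ∀ (k H L : ℕ) → k + H + L ≡ L + H + k
        regroup = solve-∀
      k+H≤E : k + H ≤ E
      k+H≤E = ≤-pred (≤-trans (+-monoˡ-≤ H k<H) 2H≤E+1)
      upper : k < (F ∸ (L + H)) + suc ((E ∸ F) + L)
      upper = subst (k <_) (sym (+-suc (F ∸ (L + H)) (E ∸ F + L)))
                    (s≤s (+-cancelʳ-≤ H k (F ∸ (L + H) + (E ∸ F + L)) (begin
        k + H                                       ≤⟨ k+H≤E ⟩
        E                                           ≡⟨ m+[n∸m]≡n F≤E ⟨
        F + (E ∸ F)                                 ≤⟨ +-monoˡ-≤ (E ∸ F) (m≤n+m∸n F (L + H)) ⟩
        (L + H) + (F ∸ (L + H)) + (E ∸ F)           ≡⟨ regroup (F ∸ (L + H)) L H (E ∸ F) ⟩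
        (F ∸ (L + H)) + ((E ∸ F) + L) + H           ∎)))
        where
        regroup : ∀ (A L H B : ℕ) → (L + H) + A + B ≡ A + (B + L) + H
        regroup = solve-∀

    halving-exponent : ∀ {E H S} → H ≤ E → E ≤ S → E ≤ H + H → (S ∸ H) + (S ∸ H) ≤ (S ∸ E) + (S ∸ E) + E
    halving-exponent {E} {H} {S} H≤E E≤S E≤2H = begin
      (S ∸ H) + (S ∸ H)                              ≡⟨ cong (λ t → t + t) S-H≡ ⟩
      (S ∸ E) + (E ∸ H) + ((S ∸ E) + (E ∸ H))        ≡⟨ regroup (S ∸ E) (E ∸ H) ⟩
      (S ∸ E) + (S ∸ E) + ((E ∸ H) + (E ∸ H))        ≤⟨ +-monoʳ-≤ ((S ∸ E) + (S ∸ E)) (+-monoˡ-≤ (E ∸ H) E-H≤H) ⟩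
      (S ∸ E) + (S ∸ E) + (H + (E ∸ H))              ≡⟨ cong ((S ∸ E) + (S ∸ E) +_) (m+[n∸m]≡n H≤E) ⟩
      (S ∸ E) + (S ∸ E) + E                          ∎
      where
      open ≤-Reasoning
      S-H≡ : S ∸ H ≡ (S ∸ E) + (E ∸ H)
      S-H≡ = trans (cong (_∸ H) (sym (m∸n+n≡m E≤S))) (+-∸-assoc (S ∸ E) H≤E)
      E-H≤H : E ∸ H ≤ H
      E-H≤H = m≤n+o⇒m∸n≤o E H E≤2H
      regroup : ∀ (A B : ℕ) → A + B + (A + B) ≡ A + A + (B + B)
      regroup = solve-∀

    level-exponent : ∀ {E S k} → k ≤ E → E ≤ S → ((S ∸ E) + k) + (S ∸ k) ≡ (S ∸ E) + (S ∸ E) + E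
    level-exponent {E} {S} {k} k≤E E≤S = begin
      ((S ∸ E) + k) + (S ∸ k)                 ≡⟨ cong (λ t → ((S ∸ E) + k) + (t ∸ k)) (sym (m∸n+n≡m E≤S)) ⟩
      ((S ∸ E) + k) + ((S ∸ E) + E ∸ k)       ≡⟨ cong (((S ∸ E) + k) +_) (+-∸-assoc (S ∸ E) k≤E) ⟩
      ((S ∸ E) + k) + ((S ∸ E) + (E ∸ k))     ≡⟨ regroup (S ∸ E) k (E ∸ k) ⟩
      (S ∸ E) + (S ∸ E) + (k + (E ∸ k))       ≡⟨ cong ((S ∸ E) + (S ∸ E) +_) (m+[n∸m]≡n k≤E) ⟩
      (S ∸ E) + (S ∸ E) + E                   ∎
      where
      open ≡-Reasoning
      regroup : ∀ (A k B : ℕ) → (A + k) + (A + B) ≡ A + A + (k + B)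
      regroup = solve-∀

    assemble : ∀ P K d L → P + suc (d + L) * (K * P) ≤ (1 + K * (L + 1)) * (d + 1) * P
    assemble P K d L = begin
      P + suc (d + L) * (K * P)                                ≤⟨ +-monoʳ-≤ P (*-monoˡ-≤ (K * P) (m≤m+n (suc (d + L)) (d * L))) ⟩
      P + (suc (d + L) + d * L) * (K * P)                      ≤⟨ +-monoˡ-≤ _ (m≤m*n P (suc d)) ⟩
      P * suc d + (suc (d + L) + d * L) * (K * P)              ≡⟨ regroup P K d L ⟩
      (1 + K * (L + 1)) * (d + 1) * P                          ∎
      where
      open ≤-Reasoning
      regroup : ∀ (P K d L : ℕ) → P * suc d + (suc (d + L) + d * L) * (K * P) ≡ (1 + K * (L + 1)) * (d + 1) * P
      regroup = solve-∀

  count-p^k-multiples : ∀ {p} → 0 < p → ∀ {k S} → k ≤ S → count (p ^ k ∣?_) 0 (p ^ S) ≡ p ^ (S ∸ k)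
  count-p^k-multiples {p} 0<p {k} {S} k≤S = trans
    (cong (count (p ^ k ∣?_) 0) (trans (cong (p ^_) (sym (m∸n+n≡m k≤S))) (^-distribˡ-+-* p (S ∸ k) k)))
    (count-multiples (m^n>0 p {{>-nonZero 0<p}} k) (p ^ (S ∸ k)))

  pairConstant : ℤ → ℤ → ℤ → ℤ → ℤ → ℤ → ℕ
  pairConstant a b c a′ b′ c′ = 1 + 16 * (ℤ.∣ discQ a b c ∣ * (ℤ.∣ c ∣ + ℤ.∣ a ∣)) * (ℤ.∣ resQ a b c a′ b′ c′ ∣ + 1)

  module _ {p} (p-prime : Prime p) where

    private
      instance
        p≢0 : NonZero p
        p≢0 = prime⇒nonZero p-prime

      0<p : 0 < p
      0<p = <-trans z<s (prime>1 p-prime)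

    -- The conjunct k ≤ E lets the bound of count²-level hold for every k.
    Level : ℤ → ℤ → ℤ → ℕ → ℕ → Pred (ℕ × ℕ) _
    Level a b c E k (x , y) = k ≤ E × p ^ k ∥ x × Root a b c (p ^ E) x y

    level? : ∀ a b c E k → Decidable (Level a b c E k)
    level? a b c E k (x , y) = (k ≤? E) ×-dec ((p ^ k ∥? x) ×-dec root? a b c (p ^ E) x y)

    count²-level : ∀ a b c {E S} k → 0 < ℤ.∣ c ∣ → 0 < ℤ.∣ discQ a b c ∣ → E ≤ S →
                   count² (level? a b c E k) (p ^ S) ≤ 16 * (ℤ.∣ discQ a b c ∣ * ℤ.∣ c ∣) * p ^ ((S ∸ E) + (S ∸ E) + E)
    count²-level a b c {E} {S} k 0<∣c∣ 0<∣δ∣ E≤S = by-cases (k ≤? E)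
      where
      K = 16 * (ℤ.∣ discQ a b c ∣ * ℤ.∣ c ∣)
      by-cases : Dec (k ≤ E) → count² (level? a b c E k) (p ^ S) ≤ K * p ^ ((S ∸ E) + (S ∸ E) + E)
      by-cases (no k≰E)  = ≤-trans (≤-reflexive (count²-empty (level? a b c E k) (p ^ S) (λ _ (k≤E , _) → k≰E k≤E))) z≤n
      by-cases (yes k≤E) = begin
        count² (level? a b c E k) (p ^ S)      ≤⟨ count²-≤-rows (level? a b c E k) (p ^ k ∥?_) (p ^ S) B exact row-bound ⟩
        B * count (p ^ k ∥?_) 0 (p ^ S)         ≤⟨ *-monoʳ-≤ B (count-mono (p ^ k ∥?_) (p ^ k ∣?_) 0 (p ^ S) proj₁) ⟩
        B * count (p ^ k ∣?_) 0 (p ^ S)         ≡⟨ cong (B *_) (count-p^k-multiples 0<p (≤-trans k≤E E≤S)) ⟩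
        K * p ^ ((S ∸ E) + k) * p ^ (S ∸ k)     ≡⟨ *-assoc K _ _ ⟩
        K * (p ^ ((S ∸ E) + k) * p ^ (S ∸ k))   ≡⟨ cong (K *_) (^-distribˡ-+-* p ((S ∸ E) + k) (S ∸ k)) ⟨
        K * p ^ (((S ∸ E) + k) + (S ∸ k))       ≡⟨ cong (λ e → K * p ^ e) (level-exponent k≤E E≤S) ⟩
        K * p ^ ((S ∸ E) + (S ∸ E) + E)         ∎
        where
        open ≤-Reasoning
        B = K * p ^ ((S ∸ E) + k)
        exact : ∀ {x y} → Level a b c E k (x , y) → p ^ k ∥ x
        exact (_ , p^k∥x , _) = p^k∥x
        row-bound : ∀ {x} → p ^ k ∥ x → count (λ y → level? a b c E k (x , y)) 0 (p ^ S) ≤ B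
        row-bound {x} p^k∥x = ≤-trans
          (count-mono (λ y → level? a b c E k (x , y)) (root? a b c (p ^ E) x) 0 (p ^ S) (λ (_ , _ , r) → r))
          (count-roots-row p-prime a b c 0<∣c∣ 0<∣δ∣ E≤S p^k∥x)

    CommonRoot : ℤ → ℤ → ℤ → ℤ → ℤ → ℤ → ℕ → ℕ → Pred (ℕ × ℕ) _
    CommonRoot a b c a′ b′ c′ E F (x , y) = Root a b c (p ^ E) x y × Root a′ b′ c′ (p ^ F) x y

    commonRoot? : ∀ a b c a′ b′ c′ E F → Decidable (CommonRoot a b c a′ b′ c′ E F)
    commonRoot? a b c a′ b′ c′ E F (x , y) = root? a b c (p ^ E) x y ×-dec root? a′ b′ c′ (p ^ F) x y

    Deep : ℕ → Pred (ℕ × ℕ) _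
    Deep H (x , y) = p ^ H ∣ x × p ^ H ∣ y

    deep? : ∀ H → Decidable (Deep H)
    deep? H (x , y) = p ^ H ∣? x ×-dec p ^ H ∣? y

    AtLevel : ℤ → ℤ → ℤ → ℕ → ℕ → Pred (ℕ × ℕ) _
    AtLevel a b c E k (x , y) = Level a b c E k (x , y) ⊎ Level c b a E k (y , x)

    -- Off the deep points, take the largest k with p^k dividing both coordinates: p^k divides
    -- one of them exactly, and the resultant bounds F by 2k + Res.
    common-root-level : ∀ a b c a′ b′ c′ {E F x y} → 0 < ℤ.∣ resQ a b c a′ b′ c′ ∣ → F ≤ E →
      CommonRoot a b c a′ b′ c′ E F (x , y) →
      Deep ⌈ E /2⌉ (x , y) ⊎ ∃ λ k → k < ⌈ E /2⌉ × F < (k + k) + ℤ.∣ resQ a b c a′ b′ c′ ∣ × AtLevel a b c E k (x , y)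
    common-root-level a b c a′ b′ c′ {E} {F} {x} {y} 0<Res F≤E (q≡0 , q′≡0) = by-depth (deep? H (x , y))
      where
      H = ⌈ E /2⌉
      Result = ∃ λ k → k < H × F < (k + k) + ℤ.∣ resQ a b c a′ b′ c′ ∣ × AtLevel a b c E k (x , y)
      level : (∃ λ k → k < H × Deep k (x , y) × ¬ Deep (suc k) (x , y)) → Result
      level (k , k<H , (p^k∣x , p^k∣y) , ¬deeper) =
        k , k<H , common-zero-bound p-prime a b c a′ b′ c′ {F} {k} {x} {y} 0<Res p^k∣x p^k∣y ¬deeper
                    (∣-trans (p^m∣p^n p F≤E) q≡0) q′≡0 ,
        side (p ^ suc k ∣? x)
        where
        k≤E = ≤-trans (<⇒≤ k<H) (⌈n/2⌉≤n E)
        side : Dec (p ^ suc k ∣ x) → AtLevel a b c E k (x , y)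
        side (no p^k+1∤x)  = inj₁ (k≤E , (p^k∣x , p^k+1∤x) , q≡0)
        side (yes p^k+1∣x) = inj₂ (k≤E , (p^k∣y , λ p^k+1∣y → ¬deeper (p^k+1∣x , p^k+1∣y)) , Root-transpose a b c q≡0)
      by-depth : Dec (Deep H (x , y)) → Deep H (x , y) ⊎ Result
      by-depth (yes deep) = inj₁ deep
      by-depth (no ¬deep) = inj₂ (level (boundary (λ k → deep? k (x , y)) H (1∣ x , 1∣ y) ¬deep))

    -- The deep points number at most p^(2(S − ⌈E/2⌉)); each other point lies at one of E − F + Res + 1
    -- levels (level-range), and each level holds at most K·p^(2(S − E) + E) points.
    count-common-roots : ∀ a b c a′ b′ c′ {E F S} → 0 < ℤ.∣ a ∣ → 0 < ℤ.∣ c ∣ → 0 < ℤ.∣ discQ a b c ∣ →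
      0 < ℤ.∣ resQ a b c a′ b′ c′ ∣ → F ≤ E → E ≤ S →
      count² (commonRoot? a b c a′ b′ c′ E F) (p ^ S)
        ≤ pairConstant a b c a′ b′ c′ * ((E ∸ F) + 1) * p ^ ((S ∸ E) + (S ∸ E) + E)
    count-common-roots a b c a′ b′ c′ {E} {F} {S} 0<∣a∣ 0<∣c∣ 0<∣δ∣ 0<Res F≤E E≤S = begin
      count² common N                                                 ≤⟨ ∑²-mono-≤ N (λ z → pointwise z (common z)) ⟩
      ∑² N (λ z → indicator (deep? H z) + ∑ k₀ n (λ k → levels k z))  ≡⟨ ∑²-distrib-+ N _ _ ⟩
      count² (deep? H) N + ∑² N (λ z → ∑ k₀ n (λ k → levels k z))     ≡⟨ cong (count² (deep? H) N +_) (∑²-∑-comm N k₀ n levels) ⟩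
      count² (deep? H) N + ∑ k₀ n (λ k → ∑² N (levels k))             ≤⟨ +-mono-≤ deep-bound (∑-≤-const k₀ n (K * P) level-bound) ⟩
      P + n * (K * P)                                                 ≤⟨ assemble P K (E ∸ F) Res ⟩
      pairConstant a b c a′ b′ c′ * ((E ∸ F) + 1) * P                 ∎
      where
      open ≤-Reasoning
      common = commonRoot? a b c a′ b′ c′ E F
      N = p ^ S
      H = ⌈ E /2⌉
      Res = ℤ.∣ resQ a b c a′ b′ c′ ∣
      ∣δ∣ = ℤ.∣ discQ a b c ∣
      k₀ = F ∸ (Res + H)
      n = suc ((E ∸ F) + Res)
      P = p ^ ((S ∸ E) + (S ∸ E) + E)
      K = 16 * (∣δ∣ * (ℤ.∣ c ∣ + ℤ.∣ a ∣))
      levels : ℕ → ℕ × ℕ → ℕ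
      levels k (x , y) = indicator (level? a b c E k (x , y)) + indicator (level? c b a E k (y , x))
      pointwise : ∀ z → (z? : Dec (CommonRoot a b c a′ b′ c′ E F z)) →
                  indicator z? ≤ indicator (deep? H z) + ∑ k₀ n (λ k → levels k z)
      pointwise z (no _)  = z≤n
      pointwise z (yes r) = covered (common-root-level a b c a′ b′ c′ 0<Res F≤E r)
        where
        level-term : ∀ {k} → AtLevel a b c E k z → 1 ≤ levels k z
        level-term (inj₁ l) = ≤-trans (≤-reflexive (sym (indicator-yes (level? a b c E _ z) l))) (m≤m+n _ _)
        level-term (inj₂ l) = ≤-trans (≤-reflexive (sym (indicator-yes (level? c b a E _ _) l))) (m≤n+m _ _)
        covered : Deep H z ⊎ (∃ λ k → k < H × F < (k + k) + Res × AtLevel a b c E k z) →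
                  1 ≤ indicator (deep? H z) + ∑ k₀ n (λ k → levels k z)
        covered (inj₁ deep) = ≤-trans (≤-reflexive (sym (indicator-yes (deep? H z) deep))) (m≤m+n _ _)
        covered (inj₂ (k , k<H , F<2k+Res , at-k)) =
          let k₀≤k , k<k₀+n = level-range F≤E (proj₂ (⌈E/2⌉-bounds E)) k<H F<2k+Res
          in ≤-trans (level-term at-k)
                     (≤-trans (term≤∑ k₀ n (λ k → levels k z) k₀≤k k<k₀+n) (m≤n+m _ (indicator (deep? H z))))
      deep-bound : count² (deep? H) N ≤ P
      deep-bound = begin
        count² (deep? H) N                             ≡⟨ count²-× (p ^ H ∣?_) N ⟩
        count (p ^ H ∣?_) 0 N * count (p ^ H ∣?_) 0 N  ≡⟨ cong (λ t → t * t) (count-p^k-multiples 0<p H≤S) ⟩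
        p ^ (S ∸ H) * p ^ (S ∸ H)                      ≡⟨ ^-distribˡ-+-* p (S ∸ H) (S ∸ H) ⟨
        p ^ ((S ∸ H) + (S ∸ H))                        ≤⟨ ^-monoʳ-≤ p (halving-exponent (⌈n/2⌉≤n E) E≤S (proj₁ (⌈E/2⌉-bounds E))) ⟩
        P                                              ∎
        where H≤S = ≤-trans (⌈n/2⌉≤n E) E≤S
      level-bound : ∀ k → ∑² N (levels k) ≤ K * P
      level-bound k = begin
        ∑² N (levels k)
          ≡⟨ ∑²-distrib-+ N _ _ ⟩
        count² (level? a b c E k) N + count² (λ (x , y) → level? c b a E k (y , x)) N
          ≡⟨ cong (count² (level? a b c E k) N +_) (count²-transpose (level? c b a E k) N) ⟩
        count² (level? a b c E k) N + count² (level? c b a E k) N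
          ≤⟨ +-mono-≤ (count²-level a b c k 0<∣c∣ 0<∣δ∣ E≤S) (count²-level c b a k 0<∣a∣ 0<∣δᵀ∣ E≤S) ⟩
        16 * (∣δ∣ * ℤ.∣ c ∣) * P + 16 * (ℤ.∣ discQ c b a ∣ * ℤ.∣ a ∣) * P
          ≡⟨ cong (λ d → 16 * (∣δ∣ * ℤ.∣ c ∣) * P + 16 * (ℤ.∣ d ∣ * ℤ.∣ a ∣) * P) (discQ-transpose a b c) ⟩
        16 * (∣δ∣ * ℤ.∣ c ∣) * P + 16 * (∣δ∣ * ℤ.∣ a ∣) * P
          ≡⟨ regroup ∣δ∣ ℤ.∣ c ∣ ℤ.∣ a ∣ P ⟩
        K * P ∎
        where
        0<∣δᵀ∣ = subst (λ d → 0 < ℤ.∣ d ∣) (sym (discQ-transpose a b c)) 0<∣δ∣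
        regroup : ∀ (d c a P : ℕ) → 16 * (d * c) * P + 16 * (d * a) * P ≡ 16 * (d * (c + a)) * P
        regroup = solve-∀

module FinProducts where

  open import Data.Nat using (ℕ; zero; suc; _+_; _*_; _^_; _≤_; _<_; z<s; >-nonZero)
  open import Data.Nat.Properties
  open import Data.Nat.Divisibility using (_∣_; ∣-trans; ∣⇒≤; m∣m*n; n∣m*n; 0∣⇒≡0)
  open import Data.Nat.Tactic.RingSolver using (solve-∀)
  open import Data.Integer as ℤ using (ℤ; +_)
  import Data.Integer.Properties as ℤ
  open import Data.Fin as Fin using (Fin; fromℕ; inject₁)
  open import Data.Fin.Permutation using (Permutation′; _⟨$⟩ʳ_)
  open import Algebra.Properties.CommutativeMonoid.Sum +-0-commutativeMonoid using (sum; sum-permute; sum-init-last)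
  open import Data.Product using (_×_; _,_)
  open import Data.Empty using (⊥-elim)
  open import Function using (_∘_)
  open import Relation.Binary.PropositionalEquality

  open import Defs
  open BinaryForms using (resQ-sym)

  sumFin≡sum : ∀ n (f : Fin n → ℕ) → sumFin n f ≡ sum f
  sumFin≡sum zero    f = refl
  sumFin≡sum (suc n) f = cong (λ t → f Fin.zero + t) (sumFin≡sum n (f ∘ Fin.suc))

  sumFin-double : ∀ n (f : Fin n → ℕ) → sumFin n (λ i → 2 * f i) ≡ sumFin n f + sumFin n f
  sumFin-double zero    f = refl
  sumFin-double (suc n) f =
    trans (cong (λ t → 2 * f Fin.zero + t) (sumFin-double n (f ∘ Fin.suc))) (regroup (f Fin.zero) _)
    where
    regroup : ∀ (a s : ℕ) → 2 * a + (s + s) ≡ a + s + (a + s)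
    regroup = solve-∀

  prodFin-^ : ∀ p n (e : Fin n → ℕ) → prodFin n (λ i → p ^ e i) ≡ p ^ sumFin n e
  prodFin-^ p zero    e = refl
  prodFin-^ p (suc n) e =
    trans (cong (λ t → p ^ e Fin.zero * t) (prodFin-^ p n (e ∘ Fin.suc))) (sym (^-distribˡ-+-* p (e Fin.zero) _))

  prodFin-const : ∀ p n → prodFin n (λ _ → p) ≡ p ^ n
  prodFin-const p zero    = refl
  prodFin-const p (suc n) = cong (p *_) (prodFin-const p n)

  prodFin-unitTuple : ∀ p n (i : Fin n) → prodFin n (unitTuple p i) ≡ p
  prodFin-unitTuple p (suc n) Fin.zero    = trans (cong (p *_) (trans (prodFin-const 1 n) (^-zeroˡ n))) (*-identityʳ p)
  prodFin-unitTuple p (suc n) (Fin.suc i) = trans (+-identityʳ _) (prodFin-unitTuple p n i)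

  unitTuple-diagonal : ∀ p {n} (i : Fin n) → unitTuple p i i ≡ p
  unitTuple-diagonal p Fin.zero    = refl
  unitTuple-diagonal p (Fin.suc i) = unitTuple-diagonal p i

  sumFin-permute : ∀ n (f : Fin n → ℕ) (σ : Permutation′ n) → sumFin n f ≡ sumFin n (λ i → f (σ ⟨$⟩ʳ i))
  sumFin-permute n f σ =
    trans (sumFin≡sum n f) (trans (sum-permute f σ) (sym (sumFin≡sum n (λ i → f (σ ⟨$⟩ʳ i)))))

  sumFin-init-last : ∀ n (f : Fin (suc n) → ℕ) → sumFin (suc n) f ≡ sumFin n (f ∘ inject₁) + f (fromℕ n)
  sumFin-init-last n f =
    trans (sumFin≡sum (suc n) f) (trans (sum-init-last f) (cong (_+ f (fromℕ n)) (sym (sumFin≡sum n (f ∘ inject₁)))))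

  ∣∣-*ˡ : ∀ i j → ℤ.∣ i ∣ ∣ ℤ.∣ i ℤ.* j ∣
  ∣∣-*ˡ i j = subst (ℤ.∣ i ∣ ∣_) (sym (ℤ.abs-* i j)) (m∣m*n ℤ.∣ j ∣)

  ∣∣-*ʳ : ∀ i j → ℤ.∣ j ∣ ∣ ℤ.∣ i ℤ.* j ∣
  ∣∣-*ʳ i j = subst (ℤ.∣ j ∣ ∣_) (sym (ℤ.abs-* i j)) (n∣m*n ℤ.∣ i ∣)

  ∣∣-prodFinℤ : ∀ n (f : Fin n → ℤ) k → ℤ.∣ f k ∣ ∣ ℤ.∣ prodFinℤ n f ∣
  ∣∣-prodFinℤ (suc n) f Fin.zero    = ∣∣-*ˡ (f Fin.zero) _
  ∣∣-prodFinℤ (suc n) f (Fin.suc k) = ∣-trans (∣∣-prodFinℤ n (f ∘ Fin.suc) k) (∣∣-*ʳ (f Fin.zero) _)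

  ∣∣-prodPairsℤ : ∀ n (f : Fin n → Fin n → ℤ) → (∀ i j → f i j ≡ f j i) →
                  ∀ {i j} → i ≢ j → ℤ.∣ f i j ∣ ∣ ℤ.∣ prodPairsℤ n f ∣
  ∣∣-prodPairsℤ (suc n) f f-sym {i} {j} i≢j = go i j i≢j
    where
    first = prodFinℤ n (λ j → f Fin.zero (Fin.suc j))
    rest = prodPairsℤ n (λ i j → f (Fin.suc i) (Fin.suc j))
    go : ∀ i j → i ≢ j → ℤ.∣ f i j ∣ ∣ ℤ.∣ first ℤ.* rest ∣
    go Fin.zero    Fin.zero    0≢0 = ⊥-elim (0≢0 refl)
    go Fin.zero    (Fin.suc j) _   = ∣-trans (∣∣-prodFinℤ n (λ j → f Fin.zero (Fin.suc j)) j) (∣∣-*ˡ first rest)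
    go (Fin.suc i) Fin.zero    _   = subst (λ r → ℤ.∣ r ∣ ∣ ℤ.∣ first ℤ.* rest ∣) (f-sym Fin.zero (Fin.suc i))
      (∣-trans (∣∣-prodFinℤ n (λ j → f Fin.zero (Fin.suc j)) i) (∣∣-*ˡ first rest))
    go (Fin.suc i) (Fin.suc j) i≢j = ∣-trans
      (∣∣-prodPairsℤ n (λ i j → f (Fin.suc i) (Fin.suc j)) (λ i j → f-sym (Fin.suc i) (Fin.suc j)) (i≢j ∘ cong Fin.suc))
      (∣∣-*ʳ first rest)

  divisor-bounds : ∀ {X M} → X ∣ M → 0 < M → 0 < X × X ≤ M
  divisor-bounds {zero}  X∣M 0<M = ⊥-elim (<-irrefl (sym (0∣⇒≡0 X∣M)) 0<M)
  divisor-bounds {suc X} X∣M 0<M = z<s , ∣⇒≤ {{>-nonZero 0<M}} X∣M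

  module _ {g} (a b c : Fin g → ℤ) where

    private
      primes = + primorialUpTo (2 * g)
      forms = prodFinℤ g (λ k → a k ℤ.* c k ℤ.* discQ (a k) (b k) (c k))
      resultants = prodPairsℤ g (λ i j → resQ (a i) (b i) (c i) (a j) (b j) (c j))
      δ = λ k → discQ (a k) (b k) (c k)

      form-factors : ∀ k → ℤ.∣ a k ℤ.* c k ℤ.* δ k ∣ ∣ ℤ.∣ bigD g a b c ∣
      form-factors k = ∣-trans (∣∣-prodFinℤ g _ k) (∣-trans (∣∣-*ʳ primes forms) (∣∣-*ˡ (primes ℤ.* forms) resultants))

    a∣D : ∀ k → ℤ.∣ a k ∣ ∣ ℤ.∣ bigD g a b c ∣
    a∣D k = ∣-trans (∣-trans (∣∣-*ˡ (a k) (c k)) (∣∣-*ˡ (a k ℤ.* c k) (δ k))) (form-factors k)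

    c∣D : ∀ k → ℤ.∣ c k ∣ ∣ ℤ.∣ bigD g a b c ∣
    c∣D k = ∣-trans (∣-trans (∣∣-*ʳ (a k) (c k)) (∣∣-*ˡ (a k ℤ.* c k) (δ k))) (form-factors k)

    δ∣D : ∀ k → ℤ.∣ discQ (a k) (b k) (c k) ∣ ∣ ℤ.∣ bigD g a b c ∣
    δ∣D k = ∣-trans (∣∣-*ʳ (a k ℤ.* c k) (δ k)) (form-factors k)

    Res∣D : ∀ {i j} → i ≢ j → ℤ.∣ resQ (a i) (b i) (c i) (a j) (b j) (c j) ∣ ∣ ℤ.∣ bigD g a b c ∣
    Res∣D i≢j = ∣-trans (∣∣-prodPairsℤ g _ (λ i j → sym (resQ-sym (a i) (b i) (c i) (a j) (b j) (c j))) i≢j)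
                        (∣∣-*ʳ (primes ℤ.* forms) resultants)

    0<∣D∣ : bigD g a b c ≢ + 0 → 0 < ℤ.∣ bigD g a b c ∣
    0<∣D∣ D≢0 = n≢0⇒n>0 (D≢0 ∘ ℤ.∣i∣≡0⇒i≡0)

module RhoBounds where

  open import Data.Nat using (ℕ; zero; suc; _+_; _*_; _∸_; _^_; _≤_; _<_; z≤n; z<s; >-nonZero; ∣_-_∣)
  open import Data.Nat.Properties
  open import Data.Nat.Divisibility using (_∣_; _∤_; _∣?_; ∣-trans; ∣⇒≤; m∣m*n; ∣1⇒≡1; >⇒∤)
  open import Data.Nat.GCD using (gcd; gcd[m,n]∣m; gcd[m,n]∣n; gcd-greatest)
  open import Data.Nat.Primality using (Prime)
  open import Data.Integer as ℤ using (ℤ; +_)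
  open import Data.Fin as Fin using (Fin; fromℕ; inject₁) renaming (_≤_ to _≤ᶠ_)
  open import Data.Fin.Properties using (fromℕ≢inject₁; ≤fromℕ)
  open import Data.Fin.Permutation using (Permutation′; _⟨$⟩ʳ_; _⟨$⟩ˡ_; inverseˡ)
  open import Data.Product using (_×_; _,_; proj₁; proj₂)
  open import Data.Sum using (inj₁; inj₂)
  open import Data.Empty using (⊥-elim)
  open import Function using (_∘_)
  open import Relation.Nullary using (¬_; Dec; yes; no)
  open import Relation.Nullary.Decidable using (_×-dec_)
  open import Relation.Binary.PropositionalEquality
  open import Data.Nat.Tactic.RingSolver using (solve-∀)

  open import Defs
  open Counting
  open Congruences
  open PrimePowers
  open Zeros
  open RowCounts
  open PairCounts
  open FinProducts

  rhoConstant : ℕ → ℕ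
  rhoConstant M = 1 + 16 * (M * (M + M)) * (M + 1)

  module _ (h : ℕ) (a b c : Fin (suc (suc h)) → ℤ) where

    private
      g = suc (suc h)
      i₀ i₁ : Fin g
      i₀ = Fin.zero
      i₁ = Fin.suc Fin.zero

    rho-prime-powers : bigD g a b c ≢ + 0 → ∀ p → Prime p → (e : Fin g → ℕ) → (σ : Permutation′ g) →
      (∀ i j → i ≤ᶠ j → e (σ ⟨$⟩ʳ i) ≤ e (σ ⟨$⟩ʳ j)) →
      rho g a b c (λ i → p ^ e i)
        ≤ rhoConstant ℤ.∣ bigD g a b c ∣ * ((e (σ ⟨$⟩ʳ fromℕ (suc h)) ∸ e (σ ⟨$⟩ʳ inject₁ (fromℕ h))) + 1)
            * p ^ (sumFin (suc h) (λ i → 2 * e (σ ⟨$⟩ʳ inject₁ i)) + e (σ ⟨$⟩ʳ fromℕ (suc h)))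
    rho-prime-powers D≢0 p p-prime e σ sorted = begin
      rho g a b c d                                ≡⟨ length-filter-square (inLambda? g a b c d) (prodFin g d) ⟩
      count² (inLambda? g a b c d) (prodFin g d)   ≡⟨ cong (count² (inLambda? g a b c d)) (prodFin-^ p g e) ⟩
      count² (inLambda? g a b c d) (p ^ S)         ≤⟨ count²-mono (inLambda? g a b c d) common (p ^ S) (λ l → l j₁ , l j₂) ⟩
      count² common (p ^ S)
        ≤⟨ count-common-roots p-prime (a j₁) (b j₁) (c j₁) (a j₂) (b j₂) (c j₂)
             (pos (a∣D a b c j₁)) (pos (c∣D a b c j₁)) (pos (δ∣D a b c j₁)) (pos Res∣D′) F≤E E≤S ⟩
      pairConstant (a j₁) (b j₁) (c j₁) (a j₂) (b j₂) (c j₂) * ((E ∸ F) + 1) * p ^ ((S ∸ E) + (S ∸ E) + E)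
        ≤⟨ *-monoˡ-≤ (p ^ ((S ∸ E) + (S ∸ E) + E)) (*-monoˡ-≤ ((E ∸ F) + 1) constant≤) ⟩
      rhoConstant ∣D∣ * ((E ∸ F) + 1) * p ^ ((S ∸ E) + (S ∸ E) + E)
        ≡⟨ cong (λ t → rhoConstant ∣D∣ * ((E ∸ F) + 1) * p ^ (t + E)) 2[S-E]≡ ⟩
      rhoConstant ∣D∣ * ((E ∸ F) + 1) * p ^ (sumFin (suc h) (λ i → 2 * e (σ ⟨$⟩ʳ inject₁ i)) + E) ∎
      where
      open ≤-Reasoning
      d = λ i → p ^ e i
      ∣D∣ = ℤ.∣ bigD g a b c ∣
      j₁ = σ ⟨$⟩ʳ fromℕ (suc h)
      j₂ = σ ⟨$⟩ʳ inject₁ (fromℕ h)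
      E = e j₁
      F = e j₂
      S = sumFin g e
      A = sumFin (suc h) (λ i → e (σ ⟨$⟩ʳ inject₁ i))
      common = commonRoot? p-prime (a j₁) (b j₁) (c j₁) (a j₂) (b j₂) (c j₂) E F
      S≡A+E : S ≡ A + E
      S≡A+E = trans (sumFin-permute g e σ) (sumFin-init-last (suc h) (λ i → e (σ ⟨$⟩ʳ i)))
      E≤S : E ≤ S
      E≤S = subst (E ≤_) (sym S≡A+E) (m≤n+m E A)
      F≤E : F ≤ E
      F≤E = sorted (inject₁ (fromℕ h)) (fromℕ (suc h)) (≤fromℕ (inject₁ (fromℕ h)))
      2[S-E]≡ : (S ∸ E) + (S ∸ E) ≡ sumFin (suc h) (λ i → 2 * e (σ ⟨$⟩ʳ inject₁ i))
      2[S-E]≡ = trans (cong (λ t → t + t) (trans (cong (_∸ E) S≡A+E) (m+n∸n≡m A E)))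
                      (sym (sumFin-double (suc h) (λ i → e (σ ⟨$⟩ʳ inject₁ i))))
      j₁≢j₂ : j₁ ≢ j₂
      j₁≢j₂ j₁≡j₂ = fromℕ≢inject₁ (trans (sym (inverseˡ σ)) (trans (cong (σ ⟨$⟩ˡ_) j₁≡j₂) (inverseˡ σ)))
      Res∣D′ = Res∣D a b c j₁≢j₂
      pos : ∀ {X} → X ∣ ∣D∣ → 0 < X
      pos X∣D = proj₁ (divisor-bounds X∣D (0<∣D∣ a b c D≢0))
      bound : ∀ {X} → X ∣ ∣D∣ → X ≤ ∣D∣
      bound X∣D = proj₂ (divisor-bounds X∣D (0<∣D∣ a b c D≢0))
      constant≤ : pairConstant (a j₁) (b j₁) (c j₁) (a j₂) (b j₂) (c j₂) ≤ rhoConstant ∣D∣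
      constant≤ = +-monoʳ-≤ 1 (*-mono-≤
        (*-monoʳ-≤ 16 (*-mono-≤ (bound (δ∣D a b c j₁)) (+-mono-≤ (bound (c∣D a b c j₁)) (bound (a∣D a b c j₁)))))
        (+-monoˡ-≤ 1 (bound Res∣D′)))

    private
      module Diagonal {p} (p-prime : Prime p) where

        N = prodFin g (λ _ → p)

        N≡p^g : N ≡ p ^ g
        N≡p^g = prodFin-const p g

        Both : ℕ × ℕ → Set
        Both (x , y) = p ∣ x × p ∣ y

        both? : ∀ z → Dec (Both z)
        both? (x , y) = p ∣? x ×-dec p ∣? y

        gcd≡1⇒¬both : ∀ {x y} → gcd (gcd x y) N ≡ 1 → ¬ Both (x , y)
        gcd≡1⇒¬both G≡1 (p∣x , p∣y) = <-irrefl (sym (∣1⇒≡1 (subst (p ∣_) G≡1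
          (gcd-greatest (gcd-greatest p∣x p∣y) (subst (p ∣_) (sym N≡p^g) (m∣m*n (p ^ suc h))))))) (prime>1 p-prime)

        ¬both⇒gcd≡1 : ∀ {x y} → ¬ Both (x , y) → gcd (gcd x y) N ≡ 1
        ¬both⇒gcd≡1 {x} {y} ¬both
          with p^n-divisor p-prime g (subst (gcd (gcd x y) N ∣_) N≡p^g (gcd[m,n]∣n (gcd x y) N))
        ... | inj₁ G≡1 = G≡1
        ... | inj₂ p∣G = ⊥-elim (¬both (∣-trans p∣gcd (gcd[m,n]∣m x y) , ∣-trans p∣gcd (gcd[m,n]∣n x y)))
          where p∣gcd = ∣-trans p∣G (gcd[m,n]∣m (gcd x y) N)

    rho≡rhoStar+p^[2g-2] : ∀ p → Prime p → rho g a b c (λ _ → p) ≡ rhoStar g a b c (λ _ → p) + p ^ (2 * suc h)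
    rho≡rhoStar+p^[2g-2] p p-prime = begin
      rho g a b c d
        ≡⟨ length-filter-square (inLambda? g a b c d) N ⟩
      count² (inLambda? g a b c d) N
        ≡⟨ ∑²-cong N partition ⟩
      ∑² N (λ z → indicator (inLambdaStar? g a b c d z) + indicator (both? z))
        ≡⟨ ∑²-distrib-+ N _ _ ⟩
      count² (inLambdaStar? g a b c d) N + count² both? N
        ≡⟨ cong₂ _+_ (sym (length-filter-square (inLambdaStar? g a b c d) N)) (count²-× (p ∣?_) N) ⟩
      rhoStar g a b c d + count (p ∣?_) 0 N * count (p ∣?_) 0 N
        ≡⟨ cong (λ t → rhoStar g a b c d + t * t) multiples ⟩
      rhoStar g a b c d + p ^ suc h * p ^ suc h
        ≡⟨ cong (_+_ (rhoStar g a b c d)) square ⟩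
      rhoStar g a b c d + p ^ (2 * suc h) ∎
      where
      open ≡-Reasoning
      open Diagonal p-prime
      d = λ (_ : Fin g) → p
      partition : ∀ z → indicator (inLambda? g a b c d z) ≡ indicator (inLambdaStar? g a b c d z) + indicator (both? z)
      partition (x , y) = indicator-partition (inLambda? g a b c d (x , y)) (gcd (gcd x y) N ≟ 1) (both? (x , y))
        (λ (p∣x , p∣y) i → Root-multiples (a i) (b i) (c i) p∣x p∣y) (λ _ → gcd≡1⇒¬both) (λ _ → ¬both⇒gcd≡1)
      multiples : count (p ∣?_) 0 N ≡ p ^ suc h
      multiples = trans (cong (count (p ∣?_) 0) (trans N≡p^g (*-comm p (p ^ suc h))))
                        (count-multiples (<-trans z<s (prime>1 p-prime)) (p ^ suc h))
      square : p ^ suc h * p ^ suc h ≡ p ^ (2 * suc h)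
      square = trans (sym (^-distribˡ-+-* p (suc h) (suc h))) (cong (λ t → p ^ (suc h + t)) (sym (+-identityʳ (suc h))))

    diagonalConstant : ℕ
    diagonalConstant = ℤ.∣ resQ (a i₀) (b i₀) (c i₀) (a i₁) (b i₁) (c i₁) ∣ ^ (2 * h + 3)

    -- A primitive common zero of q₁ and q₂ modulo p makes p divide their resultant, so ρ* vanishes
    -- unless p ≤ Res; then the trivial bound p^(2g) ≤ Res^(2g − 1) p applies.
    rhoStar-diagonal-≤ : bigD g a b c ≢ + 0 → ∀ p → Prime p → rhoStar g a b c (λ _ → p) ≤ diagonalConstant * p
    rhoStar-diagonal-≤ D≢0 p p-prime = by-cases (p ∣? Res)
      where
      open Diagonal p-prime
      d = λ (_ : Fin g) → p
      Res = ℤ.∣ resQ (a i₀) (b i₀) (c i₀) (a i₁) (b i₁) (c i₁) ∣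
      0<Res : 0 < Res
      0<Res = proj₁ (divisor-bounds (Res∣D a b c {i₀} {i₁} (λ ())) (0<∣D∣ a b c D≢0))
      p∣Res : ∀ {x y} → InLambdaStar g a b c d (x , y) → p ∣ Res
      p∣Res (l , G≡1) = subst (_∣ Res) (*-identityʳ p)
        (resultant-divisible p-prime (a i₀) (b i₀) (c i₀) (a i₁) (b i₁) (c i₁) 1 (gcd≡1⇒¬both G≡1)
                             (p^1∣ (l i₀)) (p^1∣ (l i₁)))
        where
        p^1∣ : ∀ {n} → p ∣ n → p ^ 1 ∣ n
        p^1∣ = subst (_∣ _) (sym (*-identityʳ p))
      by-cases : Dec (p ∣ Res) → rhoStar g a b c d ≤ Res ^ (2 * h + 3) * p
      by-cases (no p∤Res) = ≤-trans (≤-reflexive (trans (length-filter-square (inLambdaStar? g a b c d) N)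
                                      (count²-empty (inLambdaStar? g a b c d) N (λ _ → p∤Res ∘ p∣Res)))) z≤n
      by-cases (yes p∣Res) = begin
        rhoStar g a b c d                       ≡⟨ length-filter-square (inLambdaStar? g a b c d) N ⟩
        count² (inLambdaStar? g a b c d) N      ≤⟨ count²-≤ (inLambdaStar? g a b c d) N ⟩
        N * N                                   ≡⟨ cong (λ t → t * t) N≡p^g ⟩
        p ^ g * p ^ g                           ≡⟨ ^-distribˡ-+-* p g g ⟨
        p ^ (g + g)                             ≡⟨ cong (p ^_) (exponent h) ⟩
        p ^ (2 * h + 3 + 1)                     ≡⟨ ^-distribˡ-+-* p (2 * h + 3) 1 ⟩
        p ^ (2 * h + 3) * (p * 1)               ≡⟨ cong (p ^ (2 * h + 3) *_) (*-identityʳ p) ⟩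
        p ^ (2 * h + 3) * p                     ≤⟨ *-monoˡ-≤ p (^-monoˡ-≤ (2 * h + 3) (∣⇒≤ {{>-nonZero 0<Res}} p∣Res)) ⟩
        Res ^ (2 * h + 3) * p                   ∎
        where
        open ≤-Reasoning
        exponent : ∀ h → suc (suc h) + suc (suc h) ≡ 2 * h + 3 + 1
        exponent = solve-∀

    rho-diagonal-error : bigD g a b c ≢ + 0 → ∀ p → Prime p →
                         ∣ rho g a b c (λ _ → p) - p ^ (2 * suc h) ∣ ≤ diagonalConstant * p
    rho-diagonal-error D≢0 p p-prime = ≤-trans (≤-reflexive (begin
      ∣ rho g a b c d - P ∣            ≡⟨ cong ∣_- P ∣ (trans (rho≡rhoStar+p^[2g-2] p p-prime) (+-comm _ P)) ⟩
      ∣ P + rhoStar g a b c d - P ∣    ≡⟨ ∣-∣-comm (P + rhoStar g a b c d) P ⟩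
      ∣ P - P + rhoStar g a b c d ∣    ≡⟨ ∣m-m+n∣≡n P (rhoStar g a b c d) ⟩
      rhoStar g a b c d                ∎)) (rhoStar-diagonal-≤ D≢0 p p-prime)
      where
      open ≡-Reasoning
      d = λ (_ : Fin g) → p
      P = p ^ (2 * suc h)

    rho-unitTuple-≤ : bigD g a b c ≢ + 0 → ∀ p → Prime p → ℤ.∣ bigD g a b c ∣ < p → ∀ i →
                      rho g a b c (unitTuple p i) ≤ 2 * p
    rho-unitTuple-≤ D≢0 p p-prime ∣D∣<p i = begin
      rho g a b c d                               ≡⟨ length-filter-square (inLambda? g a b c d) (prodFin g d) ⟩
      count² (inLambda? g a b c d) (prodFin g d)  ≡⟨ cong (count² (inLambda? g a b c d)) (prodFin-unitTuple p g i) ⟩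
      count² (inLambda? g a b c d) p              ≤⟨ count²-mono (inLambda? g a b c d) roots p at-i ⟩
      count² roots p                              ≤⟨ ∑-≤-const 0 p 2 (count-roots-mod-p p-prime (a i) (b i) (c i) p∤c) ⟩
      p * 2                                       ≡⟨ *-comm p 2 ⟩
      2 * p                                       ∎
      where
      open ≤-Reasoning
      d = unitTuple p i
      roots = λ ((x , y) : ℕ × ℕ) → root? (a i) (b i) (c i) p x y
      at-i : ∀ {z} → InLambda g a b c d z → Root (a i) (b i) (c i) p (proj₁ z) (proj₂ z)
      at-i l = subst (_∣ _) (unitTuple-diagonal p i) (l i)
      p∤c : p ∤ ℤ.∣ c i ∣
      p∤c = let 0<∣c∣ , ∣c∣≤∣D∣ = divisor-bounds (c∣D a b c i) (0<∣D∣ a b c D≢0)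
            in >⇒∤ {{>-nonZero 0<∣c∣}} (≤-<-trans ∣c∣≤∣D∣ ∣D∣<p)

open import Defs
open import Data.Nat using (ℕ; suc; _+_; _*_; _∸_; _^_; _≤_; _<_; ∣_-_∣)
open import Data.Nat.Primality using (Prime)
open import Data.Integer as ℤ using (ℤ; +_; _-_)
open import Data.Integer.Divisibility using (_∣_)
open import Data.Fin using (Fin; fromℕ; inject₁) renaming (_≤_ to _≤ᶠ_)
open import Data.Fin.Permutation using (Permutation′; _⟨$⟩ʳ_)
open import Data.Product using (_×_; ∃; _,_)
open import Relation.Nullary using (¬_)
open import Relation.Binary.PropositionalEquality using (_≡_)
open RhoBounds

-- Irreducibility and a ≡ 1 (mod 4) are unused: the local counts only need D ≠ 0, i.e. nonzero
-- a, c, discriminants and resultants.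
lemma5 : (h : ℕ) → (a b c : Fin (suc (suc h)) → ℤ) →
  (∀ i → IrreducibleQ (a i) (b i) (c i)) →
  (∀ i → (+ 4) ∣ (a i - + 1)) →
  ¬ (bigD (suc (suc h)) a b c ≡ + 0) →
  (∃ λ C → ∀ p → Prime p → (e : Fin (suc (suc h)) → ℕ) →
      (σ : Permutation′ (suc (suc h))) →
      (∀ i j → i ≤ᶠ j → e (σ ⟨$⟩ʳ i) ≤ e (σ ⟨$⟩ʳ j)) →
      rho (suc (suc h)) a b c (λ i → p ^ e i)
        ≤ C * ((e (σ ⟨$⟩ʳ fromℕ (suc h)) ∸ e (σ ⟨$⟩ʳ inject₁ (fromℕ h))) + 1)
            * p ^ (sumFin (suc h) (λ i → 2 * e (σ ⟨$⟩ʳ inject₁ i))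
                   + e (σ ⟨$⟩ʳ fromℕ (suc h))))
  × (∀ p → Prime p →
      rho (suc (suc h)) a b c (λ _ → p)
        ≡ rhoStar (suc (suc h)) a b c (λ _ → p) + p ^ (2 * suc h))
  × (∃ λ C → ∀ p → Prime p →
      ∣ rho (suc (suc h)) a b c (λ _ → p) - p ^ (2 * suc h) ∣ ≤ C * p)
  × (∃ λ N → ∀ p → Prime p → N < p → ∀ i →
      rho (suc (suc h)) a b c (unitTuple p i) ≤ 2 * p)
lemma5 h a b c _ _ D≢0 =
  (rhoConstant ℤ.∣ bigD (suc (suc h)) a b c ∣ , rho-prime-powers h a b c D≢0) ,
  rho≡rhoStar+p^[2g-2] h a b c ,
  (diagonalConstant h a b c , rho-diagonal-error h a b c D≢0) ,
  (ℤ.∣ bigD (suc (suc h)) a b c ∣ , rho-unitTuple-≤ h a b c D≢0)
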